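{- Let $d$ be either $0$ or a positive square-free integer, $K=\mathbb{Q}(\sqrt{ -d})$, $R$ the ring of integers of $K$. For $n\geq1$ let $G_{1,n}=\mathrm{Aut}(\Gamma_{1,n})$ and $G_{2,n}=\mathrm{Aut}(\Gamma^{un}_{2,n})$. Then: (a) for any such $d$, $G_{1,n}\cong(S_{2n}\times S_{2n})\rtimes C_2$; (b) if $d\neq1,3$, $G_{2,n}\cong S_{2n}\times S_{2n}$; (c) if $d=1$, $G_{2,n}\cong S_{2n}\times S_{2n}\times S_{4n}$; (d) if $d=3$, $G_{2,n}\cong(S_{2n}^2\times S_{2n}^2\times S_{2n}^2)\rtimes S_3$, where $S_{2n}^2=S_{2n}\times S_{2n}$.
   Context: $S_m$ is the symmetric group on $m$ letters and $C_2$ the cyclic group of order $2$; $\mathrm{Aut}$ of an undirected graph is its group of adjacency-preserving vertex bijections. The zero-divisor graph $\Gamma(M_2(R))$ is the directed graph whose vertices are the nonzero (left or right) zero-divisors of $M_2(R)$, with an edge $v_1\to v_2$ between distinct vertices iff $v_1v_2=0$. For an integer $N\geq1$ and $t\in R$, let $S_{tc,1,t,N}=\{\lambda\begin{bmatrix}1&t\\t^2&t^3\end{bmatrix}:\lambda\in\mathbb{Z},\,1\leq|\lambda|\leq N\}$ and $S_{tc,2,N}=\{\begin{bmatrix}0&0\\0&\lambda\end{bmatrix}:\lambda\in\mathbb{Z},\,1\leq|\lambda|\leq N\}$. Let $\Gamma_{1,N}$ be the induced subgraph of $\Gamma(M_2(R))$ on $S_{tc,1,0,N}\cup S_{tc,2,N}$,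 regarded as an undirected graph. Let $U=\{\pm1\}$ if $d\neq1,3$, $U=\{\pm1,\pm i\}$ if $d=1$ ($i=\sqrt{ -1}$), $U=\{\pm1,\pm\omega,\pm\omega^2\}$ if $d=3$ ($\omega$ a primitive third root of unity); let $\Gamma_{2,N}$ be the induced subgraph of $\Gamma(M_2(R))$ on $\bigcup_{j\in U}S_{tc,1,j,N}$, and $\Gamma^{un}_{2,N}$ its underlying undirected graph (distinct $v_1,v_2$ adjacent iff $v_1v_2=0$ or $v_2v_1=0$). -}

module Defs where

open import Level using (0ℓ)
open import Data.Bool using (Bool; true; false; _xor_)
open import Data.Empty using (⊥)
open import Data.Fin as Fin using (Fin; toℕ)
open import Data.List as List using (List; []; _∷_; length; lookup)
open import Data.Nat as ℕ using (ℕ; zero; suc; _<_)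
open import Data.Nat.Divisibility using (_∣_)
open import Data.Integer as ℤ using (ℤ; +_; -_; _◃_)
open import Data.Sign using (Sign)
open import Data.Product using (Σ; ∃; _×_; _,_; proj₁; proj₂)
open import Data.Sum using (_⊎_; inj₁; inj₂)
open import Function.Bundles using (_↔_; Inverse)
open import Function.Construct.Composition using (_↔-∘_)
open import Function.Construct.Identity using (↔-id)
open import Function.Construct.Symmetry using (↔-sym)
open import Relation.Nullary using (¬_; yes; no)
open import Relation.Binary using (Rel)
open import Relation.Binary.PropositionalEquality
open import Algebra.Bundles using (Group)
open import Algebra.Morphism.Structures using (module GroupMorphisms)
import Algebra.Construct.DirectProduct as DP
import Relation.Binary.Reasoning.Setoid as SetoidReasoning

_≅ᴳ_ : Group 0ℓ 0ℓ → Group 0ℓ 0ℓ → Set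
G ≅ᴳ H = ∃ λ (f : Group.Carrier G → Group.Carrier H) →
  GroupMorphisms.IsGroupIsomorphism (Group.rawGroup G) (Group.rawGroup H) f

_×ᴳ_ : Group 0ℓ 0ℓ → Group 0ℓ 0ℓ → Group 0ℓ 0ℓ
G ×ᴳ H = DP.group G H

Perm : Set → Set
Perm A = A ↔ A

module PermLemmas {A : Set} where
  open Inverse hiding (from-cong)

  _≈ₚ_ : Rel (Perm A) 0ℓ
  σ ≈ₚ τ = ∀ x → to σ x ≡ to τ x

  from-cong : ∀ {σ τ} → σ ≈ₚ τ → ∀ x → from σ x ≡ from τ x
  from-cong {σ} {τ} eq x =
    inverseʳ σ (sym (trans (eq (from τ x)) (inverseˡ τ refl)))

PermGroup : Set → Group 0ℓ 0ℓ
PermGroup A = record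
  { Carrier = Perm A
  ; _≈_ = _≈ₚ_
  ; _∙_ = _↔-∘_
  ; ε = ↔-id A
  ; _⁻¹ = ↔-sym
  ; isGroup = record
    { isMonoid = record
      { isSemigroup = record
        { isMagma = record
          { isEquivalence = record
            { refl = λ x → refl
            ; sym = λ p x → sym (p x)
            ; trans = λ p q x → trans (p x) (q x) }
          ; ∙-cong = λ {σ} {σ'} {τ} {τ'} p q x →
              trans (cong (Inverse.to σ) (q x)) (p (Inverse.to τ' x)) }
        ; assoc = λ _ _ _ x → refl }
      ; identity = (λ _ x → refl) , (λ _ x → refl) }
    ; inverse = (λ σ x → Inverse.inverseʳ σ refl) , (λ σ x → Inverse.inverseˡ σ refl)
    ; ⁻¹-cong = λ {σ} {τ} p → from-cong {A} {σ} {τ} p }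
  }
  where open PermLemmas

Sym : ℕ → Group 0ℓ 0ℓ
Sym m = PermGroup (Fin m)

C₂ : Group 0ℓ 0ℓ
C₂ = record
  { Carrier = Bool
  ; _≈_ = _≡_
  ; _∙_ = _xor_
  ; ε = false
  ; _⁻¹ = λ b → b
  ; isGroup = record
    { isMonoid = record
      { isSemigroup = record
        { isMagma = record { isEquivalence = isEquivalence ; ∙-cong = cong₂ _xor_ }
        ; assoc = assoc }
      ; identity = (λ _ → refl) , idʳ }
    ; inverse = inv , inv
    ; ⁻¹-cong = λ p → p }
  }
  where
  assoc : ∀ x y z → (x xor y) xor z ≡ x xor (y xor z)
  assoc false y z = refl
  assoc true false z = refl
  assoc true true false = refl
  assoc true true true = refl
  idʳ : ∀ x → x xor false ≡ x
  idʳ false = refl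
  idʳ true = refl
  inv : ∀ x → x xor x ≡ false
  inv false = refl
  inv true = refl

record Aut (V : Set) (Adj : V → V → Set) : Set where
  field
    perm : Perm V
    preserves : ∀ u v → Adj u v → Adj (Inverse.to perm u) (Inverse.to perm v)
    reflects  : ∀ u v → Adj (Inverse.to perm u) (Inverse.to perm v) → Adj u v

AutGroup : (V : Set) → (V → V → Set) → Group 0ℓ 0ℓ
AutGroup V Adj = record
  { Carrier = Aut V Adj
  ; _≈_ = λ σ τ → Aut.perm σ ≈ₚ Aut.perm τ
  ; _∙_ = _∘ₐ_
  ; ε = record { perm = ↔-id V ; preserves = λ _ _ a → a ; reflects = λ _ _ a → a }
  ; _⁻¹ = invₐ
  ; isGroup = record
    { isMonoid = record
      { isSemigroup = record
        { isMagma = record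
          { isEquivalence = record
            { refl = λ x → refl
            ; sym = λ p x → sym (p x)
            ; trans = λ p q x → trans (p x) (q x) }
          ; ∙-cong = λ {σ} {σ'} {τ} {τ'} p q x →
              trans (cong (Inverse.to (Aut.perm σ)) (q x)) (p (Inverse.to (Aut.perm τ') x)) }
        ; assoc = λ _ _ _ x → refl }
      ; identity = (λ _ x → refl) , (λ _ x → refl) }
    ; inverse = (λ σ x → Inverse.inverseʳ (Aut.perm σ) refl)
              , (λ σ x → Inverse.inverseˡ (Aut.perm σ) refl)
    ; ⁻¹-cong = λ {σ} {τ} p → from-cong {V} {Aut.perm σ} {Aut.perm τ} p }
  }
  where
  open PermLemmas
  _∘ₐ_ : Aut V Adj → Aut V Adj → Aut V Adj
  σ ∘ₐ τ = record
    { perm = Aut.perm σ ↔-∘ Aut.perm τ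
    ; preserves = λ u v a → Aut.preserves σ _ _ (Aut.preserves τ u v a)
    ; reflects = λ u v a → Aut.reflects τ u v (Aut.reflects σ _ _ a) }
  invₐ : Aut V Adj → Aut V Adj
  invₐ σ = record
    { perm = ↔-sym (Aut.perm σ)
    ; preserves = λ u v a → Aut.reflects σ _ _
        (subst₂ Adj (sym (Inverse.inverseˡ (Aut.perm σ) refl))
                    (sym (Inverse.inverseˡ (Aut.perm σ) refl)) a)
    ; reflects = λ u v a → subst₂ Adj (Inverse.inverseˡ (Aut.perm σ) refl)
                    (Inverse.inverseˡ (Aut.perm σ) refl) (Aut.preserves σ _ _ a) }

record Action (H N : Group 0ℓ 0ℓ) : Set where
  private
    module H = Group H
    module N = Group N
  field
    act      : H.Carrier → N.Carrier → N.Carrier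
    act-cong : ∀ {h h' n n'} → h H.≈ h' → n N.≈ n' → act h n N.≈ act h' n'
    act-hom  : ∀ h n m → act h (n N.∙ m) N.≈ (act h n N.∙ act h m)
    act-ε    : ∀ h → act h N.ε N.≈ N.ε
    act-id   : ∀ n → act H.ε n N.≈ n
    act-comp : ∀ h h' n → act (h H.∙ h') n N.≈ act h (act h' n)

SemidirectProduct : (N H : Group 0ℓ 0ℓ) → Action H N → Group 0ℓ 0ℓ
SemidirectProduct N H α = record
  { Carrier = N.Carrier × H.Carrier
  ; _≈_ = λ x y → (proj₁ x N.≈ proj₁ y) × (proj₂ x H.≈ proj₂ y)
  ; _∙_ = _·_
  ; ε = N.ε , H.ε
  ; _⁻¹ = inv
  ; isGroup = record
    { isMonoid = record
      { isSemigroup = record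
        { isMagma = record
          { isEquivalence = record
            { refl = N.refl , H.refl
            ; sym = λ (p , q) → N.sym p , H.sym q
            ; trans = λ (p , q) (p' , q') → N.trans p p' , H.trans q q' }
          ; ∙-cong = λ (p , q) (p' , q') → N.∙-cong p (act-cong q p') , H.∙-cong q q' }
        ; assoc = assoc }
      ; identity = idˡ , idʳ }
    ; inverse = invˡ , invʳ
    ; ⁻¹-cong = λ (p , q) → act-cong (H.⁻¹-cong q) (N.⁻¹-cong p) , H.⁻¹-cong q }
  }
  where
  module N = Group N
  module H = Group H
  open Action α
  open SetoidReasoning N.setoid
  _·_ : N.Carrier × H.Carrier → N.Carrier × H.Carrier → N.Carrier × H.Carrier
  (n , h) · (n' , h') = (n N.∙ act h n') , (h H.∙ h')
  inv : N.Carrier × H.Carrier → N.Carrier × H.Carrier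
  inv (n , h) = act (h H.⁻¹) (n N.⁻¹) , h H.⁻¹
  assoc : ∀ x y z → _
  assoc (n , h) (n' , h') (n'' , h'') =
    (begin
      (n N.∙ act h n') N.∙ act (h H.∙ h') n''
        ≈⟨ N.assoc _ _ _ ⟩
      n N.∙ (act h n' N.∙ act (h H.∙ h') n'')
        ≈⟨ N.∙-congˡ (N.∙-congˡ (act-comp h h' n'')) ⟩
      n N.∙ (act h n' N.∙ act h (act h' n''))
        ≈⟨ N.∙-congˡ (N.sym (act-hom h n' (act h' n''))) ⟩
      n N.∙ act h (n' N.∙ act h' n'') ∎)
    , H.assoc h h' h''
  idˡ : ∀ x → _
  idˡ (n , h) = N.trans (N.identityˡ _) (act-id n) , H.identityˡ h
  idʳ : ∀ x → _
  idʳ (n , h) = N.trans (N.∙-congˡ (act-ε h)) (N.identityʳ n) , H.identityʳ h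
  invˡ : ∀ x → _
  invˡ (n , h) =
    (begin
      act (h H.⁻¹) (n N.⁻¹) N.∙ act (h H.⁻¹) n
        ≈⟨ N.sym (act-hom _ _ _) ⟩
      act (h H.⁻¹) (n N.⁻¹ N.∙ n)
        ≈⟨ act-cong H.refl (N.inverseˡ n) ⟩
      act (h H.⁻¹) N.ε
        ≈⟨ act-ε _ ⟩
      N.ε ∎)
    , H.inverseˡ h
  invʳ : ∀ x → _
  invʳ (n , h) =
    (begin
      n N.∙ act h (act (h H.⁻¹) (n N.⁻¹))
        ≈⟨ N.∙-congˡ (N.sym (act-comp _ _ _)) ⟩
      n N.∙ act (h H.∙ h H.⁻¹) (n N.⁻¹)
        ≈⟨ N.∙-congˡ (act-cong (H.inverseʳ h) N.refl) ⟩
      n N.∙ act H.ε (n N.⁻¹)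
        ≈⟨ N.∙-congˡ (act-id _) ⟩
      n N.∙ n N.⁻¹
        ≈⟨ N.inverseʳ n ⟩
      N.ε ∎)
    , H.inverseʳ h

swapAction : (G : Group 0ℓ 0ℓ) → Action C₂ (G ×ᴳ G)
swapAction G = record
  { act = sw
  ; act-cong = cong-sw
  ; act-hom = λ { false _ _ → G.refl , G.refl ; true _ _ → G.refl , G.refl }
  ; act-ε = λ { false → G.refl , G.refl ; true → G.refl , G.refl }
  ; act-id = λ _ → G.refl , G.refl
  ; act-comp = comp }
  where
  module G = Group G
  sw : Bool → G.Carrier × G.Carrier → G.Carrier × G.Carrier
  sw false x = x
  sw true (a , b) = b , a
  cong-sw : ∀ {h h' n n'} → h ≡ h' → Group._≈_ (G ×ᴳ G) n n' →
            Group._≈_ (G ×ᴳ G) (sw h n) (sw h' n')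
  cong-sw {false} refl p = p
  cong-sw {true} refl (p , q) = q , p
  comp : ∀ h h' n → Group._≈_ (G ×ᴳ G) (sw (h xor h') n) (sw h (sw h' n))
  comp false h' n = G.refl , G.refl
  comp true false n = G.refl , G.refl
  comp true true n = G.refl , G.refl

PowerGroup : ℕ → Group 0ℓ 0ℓ → Group 0ℓ 0ℓ
PowerGroup k G = record
  { Carrier = Fin k → G.Carrier
  ; _≈_ = λ f g → ∀ i → f i G.≈ g i
  ; _∙_ = λ f g i → f i G.∙ g i
  ; ε = λ _ → G.ε
  ; _⁻¹ = λ f i → f i G.⁻¹
  ; isGroup = record
    { isMonoid = record
      { isSemigroup = record
        { isMagma = record
          { isEquivalence = record
            { refl = λ i → G.refl
            ; sym = λ p i → G.sym (p i)
            ; trans = λ p q i → G.trans (p i) (q i) }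
          ; ∙-cong = λ p q i → G.∙-cong (p i) (q i) }
        ; assoc = λ f g h i → G.assoc (f i) (g i) (h i) }
      ; identity = (λ f i → G.identityˡ (f i)) , (λ f i → G.identityʳ (f i)) }
    ; inverse = (λ f i → G.inverseˡ (f i)) , (λ f i → G.inverseʳ (f i))
    ; ⁻¹-cong = λ p i → G.⁻¹-cong (p i) }
  }
  where module G = Group G

permuteAction : (k : ℕ) (G : Group 0ℓ 0ℓ) → Action (Sym k) (PowerGroup k G)
permuteAction k G = record
  { act = λ σ f i → f (Inverse.from σ i)
  ; act-cong = λ {σ} {σ'} {f} {f'} p q i →
      subst (λ j → f (Inverse.from σ i) G.≈ f' j) (PermLemmas.from-cong {_} {σ} {σ'} p i)
            (q (Inverse.from σ i))
  ; act-hom = λ _ _ _ i → G.refl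
  ; act-ε = λ _ i → G.refl
  ; act-id = λ _ i → G.refl
  ; act-comp = λ _ _ _ i → G.refl }
  where module G = Group G

-- The ring of integers R of K = ℚ(√-d)
--   d = 0 : K = ℚ, R = ℤ
--   d > 0 : R = ℤ[θ] with θ = (1+√-d)/2 if d ≡ 3 (mod 4), θ = √-d otherwise;
--           an element (a , b) represents a + bθ.

R : ℕ → Set
R zero = ℤ
R (suc k) = ℤ × ℤ

fromℤ : (d : ℕ) → ℤ → R d
fromℤ zero a = a
fromℤ (suc k) a = a , + 0

0R 1R : (d : ℕ) → R d
0R d = fromℤ d (+ 0)
1R d = fromℤ d (+ 1)

infixl 6 _+R_
infixl 7 _*R_
_+R_ : {d : ℕ} → R d → R d → R d
_+R_ {zero} a b = a ℤ.+ b
_+R_ {suc k} (a , b) (c , e) = (a ℤ.+ c) , (b ℤ.+ e)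

_*R_ : {d : ℕ} → R d → R d → R d
_*R_ {zero} a b = a ℤ.* b
_*R_ {suc k} (a , b) (c , e) with suc k ℕ.% 4 ℕ.≟ 3
... | yes _ = -- θ² = θ - (d+1)/4
  (a ℤ.* c ℤ.- (+ ((suc k ℕ.+ 1) ℕ./ 4)) ℤ.* (b ℤ.* e)) , (a ℤ.* e ℤ.+ b ℤ.* c ℤ.+ b ℤ.* e)
... | no _ = -- θ² = -d
  (a ℤ.* c ℤ.- (+ (suc k)) ℤ.* (b ℤ.* e)) , (a ℤ.* e ℤ.+ b ℤ.* c)

-- The set U of the paper (the units of R)
--   d = 1 : {±1, ±i},   i = √-1 = θ
--   d = 3 : {±1, ±ω, ±ω²},  ω = (-1+√-3)/2 = θ - 1,  ω² = -θ
--   otherwise : {±1}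
U : (d : ℕ) → List (R d)
U 1 = (+ 1 , + 0) ∷ (- + 1 , + 0) ∷ (+ 0 , + 1) ∷ (+ 0 , - + 1) ∷ []
U 3 = (+ 1 , + 0) ∷ (- + 1 , + 0) ∷ (- + 1 , + 1) ∷ (+ 1 , - + 1)
    ∷ (+ 0 , - + 1) ∷ (+ 0 , + 1) ∷ []
U d = 1R d ∷ fromℤ d (- + 1) ∷ []

record M₂ (d : ℕ) : Set where
  constructor mat
  field
    m11 m12 m21 m22 : R d

_·M_ : {d : ℕ} → M₂ d → M₂ d → M₂ d
mat a b c e ·M mat a' b' c' e' =
  mat (a *R a' +R b *R c') (a *R b' +R b *R e')
      (c *R a' +R e *R c') (c *R b' +R e *R e')

0M : (d : ℕ) → M₂ d
0M d = mat (0R d) (0R d) (0R d) (0R d)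

_•M_ : {d : ℕ} → ℤ → M₂ d → M₂ d
_•M_ {d} l (mat a b c e) = mat (fromℤ d l *R a) (fromℤ d l *R b) (fromℤ d l *R c) (fromℤ d l *R e)

Aₜ : {d : ℕ} → R d → M₂ d
Aₜ {d} t = mat (1R d) t (t *R t) (t *R (t *R t))

-- Integer scalars λ with 1 ≤ |λ| ≤ N, parametrised as (sign, |λ|-1)

Coef : ℕ → Set
Coef N = Sign × Fin N

coef : {N : ℕ} → Coef N → ℤ
coef (s , k) = s ◃ suc (toℕ k)

ZAdj : {d : ℕ} {V : Set} → (V → M₂ d) → V → V → Set
ZAdj {d} M u v = ¬ (u ≡ v) × ((M u ·M M v ≡ 0M d) ⊎ (M v ·M M u ≡ 0M d))

-- Γ_{1,N}: vertices S_{tc,1,0,N} ∪ S_{tc,2,N}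
--   inj₁ λ ↦ λ·[[1,0],[0,0]],  inj₂ λ ↦ [[0,0],[0,λ]]
V₁ : ℕ → Set
V₁ N = Coef N ⊎ Coef N

mat₁ : (d N : ℕ) → V₁ N → M₂ d
mat₁ d N (inj₁ l) = coef l •M Aₜ (0R d)
mat₁ d N (inj₂ l) = mat (0R d) (0R d) (0R d) (fromℤ d (coef l))

G₁ : (d N : ℕ) → Group 0ℓ 0ℓ
G₁ d N = AutGroup (V₁ N) (ZAdj (mat₁ d N))

-- Γ^{un}_{2,N}: vertices ⋃_{j ∈ U} S_{tc,1,j,N};  (j , λ) ↦ λ·[[1,j],[j²,j³]]
V₂ : (d N : ℕ) → Set
V₂ d N = Fin (length (U d)) × Coef N

mat₂ : (d N : ℕ) → V₂ d N → M₂ d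
mat₂ d N (j , l) = coef l •M Aₜ (lookup (U d) j)

G₂ : (d N : ℕ) → Group 0ℓ 0ℓ
G₂ d N = AutGroup (V₂ d N) (ZAdj (mat₂ d N))

SquareFree : ℕ → Set
SquareFree d = ∀ m → m ℕ.* m ∣ d → m ≡ 1

Admissible : ℕ → Set
Admissible d = d ≡ 0 ⊎ (0 < d × SquareFree d)

module Submission where

-- The vertices λ·A of these graphs come in blocks, one block per matrix A, and since λ ranges over
-- nonzero integers, (λ·A)(μ·B) = 0 exactly when AB = 0: adjacency of distinct vertices depends only on
-- their blocks. Evaluating the finitely many products AB identifies the graphs: Γ₁,ₙ is the complete
-- bipartite graph K₂ₙ,₂ₙ; for d ≠ 1, 3, Γ₂,ₙ is an independent 2n-set (λ·A₁) joined to a 2n-clique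
-- (λ·A₋₁); for d = 1 the independent set λ·A₁ is joined to the clique λ·A₋₁ and to the independent
-- 4n-set λ·A₊ᵢ ∪ λ·A₋ᵢ; for d = 3 the graph is three disjoint copies of the one for d ≠ 1, 3, one copy
-- for each pair ±1, ±ω, ±ω². For Γ₁,ₙ and for d ≠ 1, 3 all entries are integers, so the graphs do not
-- depend on d. Automorphisms of the model graphs preserve the blocks up to their evident symmetries,
-- as graph invariants show: dominating vertices, vertices with a neighbour in no triangle, connected
-- components; and an automorphism of K_{P,P} either fixes or swaps the two sides.

open import Defs
open import Level using (0ℓ)
open import Algebra.Bundles using (Group)
import Algebra.Properties.Group as GroupProperties
open import Data.Bool as Bool using (Bool; true; false; T; _xor_; _∧_; _∨_)
open import Data.Bool.Properties using (xor-assoc; xor-comm; xor-same; xor-identityʳ; T-∨; T-∧)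
open import Data.Empty using (⊥; ⊥-elim)
open import Data.Fin as Fin using (Fin; zero; suc)
import Data.Fin.Properties as Fin
open import Data.Integer as ℤ using (ℤ; +_; -_)
import Data.Integer.Properties as ℤ
open import Data.Integer.Tactic.RingSolver using (solve-∀)
open import Data.List using (List; []; _∷_; lookup; length)
open import Data.Nat as ℕ using (ℕ; zero; suc; _≤_; _*_; s≤s)
import Data.Nat.Properties as ℕ
open import Data.Product using (∃; ∃₂; _×_; _,_; proj₁; proj₂)
open import Data.Product.Algebra using (×-distribʳ-⊎; ×-assoc)
open import Data.Product.Function.NonDependent.Propositional using (_×-↔_; _×-⇔_)
open import Data.Product.Properties using (≡-dec; ,-injectiveʳ)
open import Data.Sign using (Sign)
open import Data.Sum using (_⊎_; inj₁; inj₂)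
open import Data.Sum.Algebra using (⊎-assoc)
open import Data.Sum.Function.Propositional using (_⊎-↔_; _⊎-⇔_)
open import Data.Sum.Properties using (inj₁-injective; inj₂-injective)
open import Data.Unit using (⊤; tt)
open import Function using (_∘_; _on_)
open import Function.Bundles using (_↔_; Inverse; mk↔ₛ′; _⇔_; mk⇔; Equivalence; Injection)
open import Function.Construct.Composition using (_↔-∘_; _⇔-∘_)
open import Function.Construct.Identity using (⇔-id; ↔-id)
open import Function.Construct.Symmetry using (↔-sym; ⇔-sym)
open import Function.Properties.Inverse using (↔⇒↣)
open import Relation.Binary.Core using (Rel)
open import Relation.Binary.Definitions using (DecidableEquality)
open import Relation.Binary.PropositionalEquality
import Relation.Binary.Reasoning.Setoid as SetoidReasoning
open import Relation.Nullary using (¬_; yes; no; Dec)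
open import Relation.Nullary.Decidable using (isYes; from-yes; toWitness; fromWitness; map′)

-- Isomorphisms with an explicit inverse; as a record type, unlike _≅ᴳ_, it lets Agda infer the groups.
infix 3 _≃ᴳ_

record _≃ᴳ_ (G H : Group 0ℓ 0ℓ) : Set where
  private
    module G = Group G
    module H = Group H
  field
    to        : G.Carrier → H.Carrier
    from      : H.Carrier → G.Carrier
    to-cong   : ∀ {x y} → x G.≈ y → to x H.≈ to y
    from-cong : ∀ {x y} → x H.≈ y → from x G.≈ from y
    homo      : ∀ x y → to (x G.∙ y) H.≈ to x H.∙ to y
    to-from   : ∀ y → to (from y) H.≈ y
    from-to   : ∀ x → from (to x) G.≈ x

≃ᴳ⇒≅ᴳ : ∀ {G H} → G ≃ᴳ H → G ≅ᴳ H
≃ᴳ⇒≅ᴳ {G} {H} φ = to , record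
  { isGroupMonomorphism = record
    { isGroupHomomorphism = record
      { isMonoidHomomorphism = record
        { isMagmaHomomorphism = record
          { isRelHomomorphism = record { cong = to-cong }
          ; homo = homo }
        ; ε-homo = ε-homo }
      ; ⁻¹-homo = ⁻¹-homo }
    ; injective = λ {x} {y} p → G.trans (G.sym (from-to x)) (G.trans (from-cong p) (from-to y)) }
  ; surjective = λ y → from y , λ p → H.trans (to-cong p) (to-from y) }
  where
  module G = Group G
  module H = Group H
  open _≃ᴳ_ φ
  open SetoidReasoning H.setoid
  ε-homo : to G.ε H.≈ H.ε
  ε-homo = GroupProperties.identityˡ-unique H (to G.ε) (to G.ε) (begin
    to G.ε H.∙ to G.ε ≈⟨ homo G.ε G.ε ⟨
    to (G.ε G.∙ G.ε)  ≈⟨ to-cong (G.identityˡ G.ε) ⟩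
    to G.ε            ∎)
  ⁻¹-homo : ∀ x → to (x G.⁻¹) H.≈ to x H.⁻¹
  ⁻¹-homo x = GroupProperties.inverseˡ-unique H (to (x G.⁻¹)) (to x) (begin
    to (x G.⁻¹) H.∙ to x ≈⟨ homo (x G.⁻¹) x ⟨
    to (x G.⁻¹ G.∙ x)    ≈⟨ to-cong (G.inverseˡ x) ⟩
    to G.ε               ≈⟨ ε-homo ⟩
    H.ε                  ∎)

≃ᴳ-trans : ∀ {G H K} → G ≃ᴳ H → H ≃ᴳ K → G ≃ᴳ K
≃ᴳ-trans {G} {K = K} φ ψ = record
  { to = ψ.to ∘ φ.to
  ; from = φ.from ∘ ψ.from
  ; to-cong = ψ.to-cong ∘ φ.to-cong
  ; from-cong = φ.from-cong ∘ ψ.from-cong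
  ; homo = λ x y → K.trans (ψ.to-cong (φ.homo x y)) (ψ.homo (φ.to x) (φ.to y))
  ; to-from = λ z → K.trans (ψ.to-cong (φ.to-from (ψ.from z))) (ψ.to-from z)
  ; from-to = λ x → G.trans (φ.from-cong (ψ.from-to (φ.to x))) (φ.from-to x) }
  where
  module φ = _≃ᴳ_ φ
  module ψ = _≃ᴳ_ ψ
  module G = Group G
  module K = Group K

×ᴳ-cong : ∀ {G G' H H'} → G ≃ᴳ G' → H ≃ᴳ H' → (G ×ᴳ H) ≃ᴳ (G' ×ᴳ H')
×ᴳ-cong φ ψ = record
  { to = λ (x , y) → φ.to x , ψ.to y
  ; from = λ (x , y) → φ.from x , ψ.from y
  ; to-cong = λ (p , q) → φ.to-cong p , ψ.to-cong q
  ; from-cong = λ (p , q) → φ.from-cong p , ψ.from-cong q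
  ; homo = λ (x , y) (x' , y') → φ.homo x x' , ψ.homo y y'
  ; to-from = λ (x , y) → φ.to-from x , ψ.to-from y
  ; from-to = λ (x , y) → φ.from-to x , ψ.from-to y }
  where
  module φ = _≃ᴳ_ φ
  module ψ = _≃ᴳ_ ψ

Wreath : ℕ → Group 0ℓ 0ℓ → Group 0ℓ 0ℓ
Wreath k G = SemidirectProduct (PowerGroup k G) (Sym k) (permuteAction k G)

wreath-cong : ∀ k {G H} → G ≃ᴳ H → Wreath k G ≃ᴳ Wreath k H
wreath-cong k φ = record
  { to = λ (f , π) → φ.to ∘ f , π
  ; from = λ (f , π) → φ.from ∘ f , π
  ; to-cong = λ (p , q) → φ.to-cong ∘ p , q
  ; from-cong = λ (p , q) → φ.from-cong ∘ p , q
  ; homo = λ (f , π) (f' , π') → (λ i → φ.homo (f i) (f' (Inverse.from π i))) , λ _ → refl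
  ; to-from = λ (f , π) → φ.to-from ∘ f , λ _ → refl
  ; from-to = λ (f , π) → φ.from-to ∘ f , λ _ → refl }
  where module φ = _≃ᴳ_ φ

-- Automorphism groups of graphs

↔-injective : {A B : Set} (e : A ↔ B) → ∀ {x y} → Inverse.to e x ≡ Inverse.to e y → x ≡ y
↔-injective e = Injection.injective (↔⇒↣ e)

≡⇒⇔ : {A : Set} (R : Rel A 0ℓ) → ∀ {x x' y y'} → x ≡ x' → y ≡ y' → R x y ⇔ R x' y'
≡⇒⇔ R refl refl = ⇔-id _

module _ {V : Set} {A : Rel V 0ℓ} where

  apply unapply : Aut V A → V → V
  apply = Inverse.to ∘ Aut.perm
  unapply = Inverse.from ∘ Aut.perm

  apply-unapply : ∀ σ x → apply σ (unapply σ x) ≡ x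
  apply-unapply σ = Inverse.strictlyInverseˡ (Aut.perm σ)

  unapply-apply : ∀ σ x → unapply σ (apply σ x) ≡ x
  unapply-apply σ = Inverse.strictlyInverseʳ (Aut.perm σ)

  inverseAut : Aut V A → Aut V A
  inverseAut = Group._⁻¹ (AutGroup V A)

  adjacency⇔ : ∀ σ u v → A u v ⇔ A (apply σ u) (apply σ v)
  adjacency⇔ σ u v = mk⇔ (Aut.preserves σ u v) (Aut.reflects σ u v)

  mkAut : (π : Perm V) → (∀ u v → A u v ⇔ A (Inverse.to π u) (Inverse.to π v)) → Aut V A
  mkAut π π⇔ = record
    { perm = π
    ; preserves = λ u v → Equivalence.to (π⇔ u v)
    ; reflects = λ u v → Equivalence.from (π⇔ u v) }

Aut-cong : ∀ {V W} {A : Rel V 0ℓ} {B : Rel W 0ℓ} (e : V ↔ W) →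
  (∀ u v → A u v ⇔ B (Inverse.to e u) (Inverse.to e v)) → AutGroup V A ≃ᴳ AutGroup W B
Aut-cong {A = A} {B} e A⇔B = record
  { to = λ σ → mkAut (e ↔-∘ (Aut.perm σ ↔-∘ ↔-sym e))
      λ x y → A⇔B _ _ ⇔-∘ (adjacency⇔ σ _ _ ⇔-∘ B⇔A x y)
  ; from = λ σ → mkAut (↔-sym e ↔-∘ (Aut.perm σ ↔-∘ e))
      λ u v → B⇔A _ _ ⇔-∘ (adjacency⇔ σ _ _ ⇔-∘ A⇔B u v)
  ; to-cong = λ p x → cong E (p (E⁻¹ x))
  ; from-cong = λ p u → cong E⁻¹ (p (E u))
  ; homo = λ σ τ x → cong (E ∘ apply σ) (sym (Inverse.strictlyInverseʳ e _))
  ; to-from = λ σ x → trans (Inverse.strictlyInverseˡ e _) (cong (apply σ) (Inverse.strictlyInverseˡ e x))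
  ; from-to = λ σ u → trans (Inverse.strictlyInverseʳ e _) (cong (apply σ) (Inverse.strictlyInverseʳ e u)) }
  where
  E = Inverse.to e
  E⁻¹ = Inverse.from e
  B⇔A : ∀ x y → B x y ⇔ A (E⁻¹ x) (E⁻¹ y)
  B⇔A x y = ⇔-sym (A⇔B _ _) ⇔-∘ ≡⇒⇔ B (sym (Inverse.strictlyInverseˡ e x)) (sym (Inverse.strictlyInverseˡ e y))

PermutationInvariant : {V : Set} → Rel V 0ℓ → Set
PermutationInvariant {V} A = ∀ (π : Perm V) u v → A u v → A (Inverse.to π u) (Inverse.to π v)

Aut≃Perm : ∀ {V} {A : Rel V 0ℓ} → PermutationInvariant A → AutGroup V A ≃ᴳ PermGroup V
Aut≃Perm {A = A} inv = record
  { to = Aut.perm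
  ; from = λ π → mkAut π λ u v → mk⇔ (inv π u v) (reflect π u v)
  ; to-cong = λ p → p
  ; from-cong = λ p → p
  ; homo = λ _ _ _ → refl
  ; to-from = λ _ _ → refl
  ; from-to = λ _ _ → refl }
  where
  reflect : ∀ π u v → A (Inverse.to π u) (Inverse.to π v) → A u v
  reflect π u v a = subst₂ A (Inverse.strictlyInverseʳ π u) (Inverse.strictlyInverseʳ π v) (inv (↔-sym π) _ _ a)

distinctOn-permutationInvariant : ∀ {P V : Set} (f : P → V) → (∀ {x y} → f x ≡ f y → x ≡ y) →
  (X : Set) → PermutationInvariant (λ x y → f x ≢ f y × X)
distinctOn-permutationInvariant f f-inj X π x y (fx≢fy , p) =
  (λ eq → fx≢fy (cong f (↔-injective π (f-inj eq)))) , p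

restrict : ∀ {V P Q : Set} (π : Perm V) (i : P → V) (j : Q → V) →
  (∀ {x y} → i x ≡ i y → x ≡ y) → (∀ {x y} → j x ≡ j y → x ≡ y) →
  (∀ p → ∃ λ q → Inverse.to π (i p) ≡ j q) → (∀ q → ∃ λ p → Inverse.from π (j q) ≡ i p) →
  P ↔ Q
restrict π i j i-inj j-inj into back = mk↔ₛ′ (proj₁ ∘ into) (proj₁ ∘ back)
  (λ q → j-inj (begin
    j (proj₁ (into (proj₁ (back q)))) ≡⟨ proj₂ (into _) ⟨
    Inverse.to π (i (proj₁ (back q))) ≡⟨ cong (Inverse.to π) (proj₂ (back q)) ⟨
    Inverse.to π (Inverse.from π (j q)) ≡⟨ Inverse.strictlyInverseˡ π (j q) ⟩
    j q ∎))
  (λ p → i-inj (begin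
    i (proj₁ (back (proj₁ (into p)))) ≡⟨ proj₂ (back _) ⟨
    Inverse.from π (j (proj₁ (into p))) ≡⟨ cong (Inverse.from π) (proj₂ (into p)) ⟨
    Inverse.from π (Inverse.to π (i p)) ≡⟨ Inverse.strictlyInverseʳ π (i p) ⟩
    i p ∎))
  where open ≡-Reasoning

KeepsLeft : {P Q : Set} → Rel (P ⊎ Q) 0ℓ → Set
KeepsLeft {P} {Q} B = ∀ (σ : Aut (P ⊎ Q) B) p → ∃ λ p' → apply σ (inj₁ p) ≡ inj₁ p'

keepsLeft⇒keepsRight : ∀ {P Q} {B : Rel (P ⊎ Q) 0ℓ} → KeepsLeft B →
  ∀ (σ : Aut (P ⊎ Q) B) q → ∃ λ q' → apply σ (inj₂ q) ≡ inj₂ q'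
keepsLeft⇒keepsRight keeps σ q with apply σ (inj₂ q) in eq
... | inj₂ q' = q' , refl
... | inj₁ p with keeps (inverseAut σ) p
...   | p' , back with trans (sym (trans (cong (unapply σ) (sym eq)) (unapply-apply σ (inj₂ q)))) back
...     | ()

module _ {P Q : Set} {B : Rel (P ⊎ Q) 0ℓ} (X : Set)
  (cross : ∀ p q → B (inj₁ p) (inj₂ q) ⇔ X) (cross' : ∀ p q → B (inj₂ q) (inj₁ p) ⇔ X)
  (keepsLeft : KeepsLeft B) where

  private
    keepsRight = keepsLeft⇒keepsRight keepsLeft

    module _ (σ : Aut (P ⊎ Q) B) where
      left : Aut P (B on inj₁)
      left = mkAut (restrict (Aut.perm σ) inj₁ inj₁ inj₁-injective inj₁-injective
                      (keepsLeft σ) (keepsLeft (inverseAut σ)))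
        λ x y → ≡⇒⇔ B (proj₂ (keepsLeft σ x)) (proj₂ (keepsLeft σ y)) ⇔-∘ adjacency⇔ σ _ _
      right : Aut Q (B on inj₂)
      right = mkAut (restrict (Aut.perm σ) inj₂ inj₂ inj₂-injective inj₂-injective
                       (keepsRight σ) (keepsRight (inverseAut σ)))
        λ x y → ≡⇒⇔ B (proj₂ (keepsRight σ x)) (proj₂ (keepsRight σ y)) ⇔-∘ adjacency⇔ σ _ _

    glue : Aut P (B on inj₁) × Aut Q (B on inj₂) → Aut (P ⊎ Q) B
    glue (α , β) = mkAut (Aut.perm α ⊎-↔ Aut.perm β) glue⇔
      where
      glue⇔ : ∀ u v → B u v ⇔ B (Inverse.to (Aut.perm α ⊎-↔ Aut.perm β) u) (Inverse.to (Aut.perm α ⊎-↔ Aut.perm β) v)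
      glue⇔ (inj₁ x) (inj₁ y) = adjacency⇔ α x y
      glue⇔ (inj₁ x) (inj₂ y) = ⇔-sym (cross _ _) ⇔-∘ cross x y
      glue⇔ (inj₂ x) (inj₁ y) = ⇔-sym (cross' _ _) ⇔-∘ cross' y x
      glue⇔ (inj₂ x) (inj₂ y) = adjacency⇔ β x y

  Aut⊎≃× : AutGroup (P ⊎ Q) B ≃ᴳ (AutGroup P (B on inj₁) ×ᴳ AutGroup Q (B on inj₂))
  Aut⊎≃× = record
    { to = λ σ → left σ , right σ
    ; from = glue
    ; to-cong = λ {σ} {τ} σ≈τ →
        (λ x → inj₁-injective (trans (sym (left-apply σ x)) (trans (σ≈τ (inj₁ x)) (left-apply τ x))))
      , (λ x → inj₂-injective (trans (sym (right-apply σ x)) (trans (σ≈τ (inj₂ x)) (right-apply τ x))))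
    ; from-cong = λ { (p , q) (inj₁ x) → cong inj₁ (p x) ; (p , q) (inj₂ x) → cong inj₂ (q x) }
    ; homo = λ σ τ →
        (λ x → inj₁-injective (trans (sym (left-apply (σ ∙ τ) x))
                 (trans (cong (apply σ) (left-apply τ x)) (left-apply σ _))))
      , (λ x → inj₂-injective (trans (sym (right-apply (σ ∙ τ) x))
                 (trans (cong (apply σ) (right-apply τ x)) (right-apply σ _))))
    ; to-from = λ αβ → (λ x → inj₁-injective (sym (left-apply (glue αβ) x)))
                     , (λ x → inj₂-injective (sym (right-apply (glue αβ) x)))
    ; from-to = λ { σ (inj₁ x) → sym (left-apply σ x) ; σ (inj₂ x) → sym (right-apply σ x) } }
    where
    _∙_ = Group._∙_ (AutGroup (P ⊎ Q) B)
    left-apply : ∀ σ x → apply σ (inj₁ x) ≡ inj₁ (apply (left σ) x)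
    left-apply σ x = proj₂ (keepsLeft σ x)
    right-apply : ∀ σ x → apply σ (inj₂ x) ≡ inj₂ (apply (right σ) x)
    right-apply σ x = proj₂ (keepsRight σ x)

Copies : (k : ℕ) {W : Set} → Rel W 0ℓ → Rel (Fin k × W) 0ℓ
Copies k A (i , x) (j , y) = i ≡ j × A x y

Diameter≤2 : {W : Set} → Rel W 0ℓ → Set
Diameter≤2 A = ∀ x y → x ≡ y ⊎ A x y ⊎ ∃ λ z → A x z × A z y

module _ {k : ℕ} {W : Set} {A : Rel W 0ℓ} (w₀ : W) (diameter≤2 : Diameter≤2 A) where

  private
    V = Fin k × W
    C = Copies k A
    _∙_ = Group._∙_ (AutGroup V C)

  sameCopy : ∀ (σ : Aut V C) i x y → proj₁ (apply σ (i , x)) ≡ proj₁ (apply σ (i , y))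
  sameCopy σ i x y with diameter≤2 x y
  ... | inj₁ refl = refl
  ... | inj₂ (inj₁ a) = proj₁ (Aut.preserves σ _ _ (refl , a))
  ... | inj₂ (inj₂ (z , a , b)) =
    trans (proj₁ (Aut.preserves σ _ _ (refl , a))) (proj₁ (Aut.preserves σ _ _ (refl , b)))

  copyMap : Aut V C → Fin k → Fin k
  copyMap σ i = proj₁ (apply σ (i , w₀))

  copyMap-apply : ∀ σ v → proj₁ (apply σ v) ≡ copyMap σ (proj₁ v)
  copyMap-apply σ (i , x) = sameCopy σ i x w₀

  copyPerm : Aut V C → Perm (Fin k)
  copyPerm σ = mk↔ₛ′ (copyMap σ) (copyMap (inverseAut σ))
    (λ i → trans (sym (copyMap-apply σ (unapply σ (i , w₀)))) (cong proj₁ (apply-unapply σ (i , w₀))))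
    (λ i → trans (sym (copyMap-apply (inverseAut σ) (apply σ (i , w₀)))) (cong proj₁ (unapply-apply σ (i , w₀))))

  private
    source : Aut V C → Fin k → Fin k
    source σ = Inverse.from (copyPerm σ)

    moveCopy : ∀ {i j : Fin k} (x : W) → i ≡ j → (i , x) ≡ (j , x)
    moveCopy x refl = refl

  copyAut : Aut V C → Fin k → Aut W A
  copyAut σ i = mkAut (restrict (Aut.perm σ) (source σ i ,_) (i ,_) ,-injectiveʳ ,-injectiveʳ into back)
    λ x y → mk⇔ proj₂ (refl ,_) ⇔-∘ (≡⇒⇔ C (proj₂ (into x)) (proj₂ (into y))
              ⇔-∘ (adjacency⇔ σ _ _ ⇔-∘ mk⇔ (refl ,_) proj₂))
    where
    into : ∀ x → ∃ λ y → apply σ (source σ i , x) ≡ (i , y)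
    into x = proj₂ (apply σ (source σ i , x)) , moveCopy _ (trans (copyMap-apply σ _) (Inverse.strictlyInverseˡ (copyPerm σ) i))
    back : ∀ y → ∃ λ x → unapply σ (i , y) ≡ (source σ i , x)
    back y = proj₂ (unapply σ (i , y)) , moveCopy _ (copyMap-apply (inverseAut σ) (i , y))

  apply-from-copy : ∀ σ i j x → j ≡ source σ i → apply σ (j , x) ≡ (i , apply (copyAut σ i) x)
  apply-from-copy σ i _ x refl = moveCopy _ (trans (copyMap-apply σ _) (Inverse.strictlyInverseˡ (copyPerm σ) i))

  -- (f , π) acts by (i , x) ↦ (π i , f (π i) x), matching the action f ↦ f ∘ π⁻¹ of permuteAction.
  fromWreath : Group.Carrier (Wreath k (AutGroup W A)) → Aut V C
  fromWreath (f , π) = mkAut perm adjacency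
    where
    perm : Perm V
    perm = mk↔ₛ′ (λ (i , x) → Inverse.to π i , apply (f (Inverse.to π i)) x)
                 (λ (i , x) → Inverse.from π i , unapply (f i) x)
                 (λ (i , x) → retract i (Inverse.strictlyInverseˡ π i))
                 (λ (i , x) → cong₂ _,_ (Inverse.strictlyInverseʳ π i) (unapply-apply (f _) x))
      where
      retract : ∀ {x} i {j} → j ≡ i → (j , apply (f j) (unapply (f i) x)) ≡ (i , x)
      retract i refl = cong (i ,_) (apply-unapply (f i) _)
    adjacency : ∀ u v → C u v ⇔ C (Inverse.to perm u) (Inverse.to perm v)
    adjacency (i , x) (j , y) = mk⇔ preserve reflect
      where
      preserve : C (i , x) (j , y) → C (Inverse.to perm (i , x)) (Inverse.to perm (j , y))
      preserve (refl , a) = refl , Aut.preserves (f _) x y a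
      reflect : C (Inverse.to perm (i , x)) (Inverse.to perm (j , y)) → C (i , x) (j , y)
      reflect (e , a) with ↔-injective π e
      ... | refl = refl , Aut.reflects (f _) x y a

  Aut-Copies≃Wreath : AutGroup (Fin k × W) (Copies k A) ≃ᴳ Wreath k (AutGroup W A)
  Aut-Copies≃Wreath = record
    { to = λ σ → copyAut σ , copyPerm σ
    ; from = fromWreath
    ; to-cong = λ {σ} {τ} σ≈τ →
        (λ i x → cong proj₂ (trans (sym (apply-from-copy σ i _ x refl))
                   (trans (σ≈τ _) (apply-from-copy τ i _ x
                     (cong proj₁ (PermLemmas.from-cong {σ = Aut.perm σ} {Aut.perm τ} σ≈τ (i , w₀)))))))
      , (λ i → cong proj₁ (σ≈τ (i , w₀)))
    ; from-cong = λ {(f , π)} {(g , ρ)} (f≈g , π≈ρ) (i , x) →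
        cong₂ _,_ (π≈ρ i) (trans (f≈g (Inverse.to π i) x) (cong (λ j → apply (g j) x) (π≈ρ i)))
    ; homo = λ σ τ →
        (λ i x → cong proj₂ (trans (sym (apply-from-copy (σ ∙ τ) i _ x refl))
                   (trans (cong (apply σ) (apply-from-copy τ (source σ i) _ x
                            (copyMap-apply (inverseAut τ) (unapply σ (i , w₀)))))
                          (apply-from-copy σ i _ _ refl))))
      , (λ i → copyMap-apply σ (apply τ (i , w₀)))
    ; to-from = λ (f , π) →
        (λ i x → trans (cong proj₂ (sym (apply-from-copy (fromWreath (f , π)) i _ x refl)))
                       (cong (λ j → apply (f j) x) (Inverse.strictlyInverseˡ π i)))
      , (λ i → refl)
    ; from-to = λ σ (i , x) →
        sym (apply-from-copy σ (copyMap σ i) i x (sym (Inverse.strictlyInverseʳ (copyPerm σ) i))) }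

-- Block graphs and invariants of automorphisms

BlockGraph : {V K : Set} → (V → K) → (K → K → Bool) → Rel V 0ℓ
BlockGraph blk t u v = u ≢ v × T (t (blk u) (blk v))

BlockGraph-relabel : ∀ {V W K L : Set} {blk : V → K} {blk' : W → L} {t : K → K → Bool} {t' : L → L → Bool}
  (e : V ↔ W) (ρ : K → L) → (∀ u → blk' (Inverse.to e u) ≡ ρ (blk u)) → (∀ i j → t' (ρ i) (ρ j) ≡ t i j) →
  ∀ u v → BlockGraph blk t u v ⇔ BlockGraph blk' t' (Inverse.to e u) (Inverse.to e v)
BlockGraph-relabel {t' = t'} e ρ blk-e t-ρ u v = mk⇔
  (λ (u≢v , adj) → u≢v ∘ ↔-injective e , subst T (sym same-table) adj)
  (λ (eu≢ev , adj) → eu≢ev ∘ cong (Inverse.to e) , subst T same-table adj)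
  where
  same-table = trans (cong₂ t' (blk-e u) (blk-e v)) (t-ρ _ _)

onCopies : ∀ {k} {W K : Set} → (W → K) → Fin k × W → Fin k × K
onCopies blk (i , x) = i , blk x

copiesTable : ∀ {k} {K : Set} → (K → K → Bool) → Fin k × K → Fin k × K → Bool
copiesTable t (i , a) (j , b) = isYes (i Fin.≟ j) ∧ t a b

Copies⇔BlockGraph : ∀ {k W K} (blk : W → K) (t : K → K → Bool) u v →
  Copies k (BlockGraph blk t) u v ⇔ BlockGraph (onCopies blk) (copiesTable t) u v
Copies⇔BlockGraph blk t (i , x) (j , y) = mk⇔ to from
  where
  to : Copies _ (BlockGraph blk t) (i , x) (j , y) → _
  to (refl , x≢y , adj) = x≢y ∘ cong proj₂ , Equivalence.from T-∧ (fromWitness {a? = i Fin.≟ i} refl , adj)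
  from : BlockGraph (onCopies blk) (copiesTable t) (i , x) (j , y) → _
  from (ix≢jy , adj) with Equivalence.to (T-∧ {isYes (i Fin.≟ j)}) adj
  ... | same , adj' with toWitness {a? = i Fin.≟ j} same
  ...   | refl = refl , ix≢jy ∘ cong (i ,_) , adj'

module _ {V : Set} (A : Rel V 0ℓ) where

  Invariant : (V → Set) → Set
  Invariant Φ = ∀ (σ : Aut V A) u → Φ u → Φ (apply σ u)

  Dominating : V → Set
  Dominating u = ∀ v → u ≢ v → A u v

  InTriangle : V → Set
  InTriangle u = ∃₂ λ v w → A u v × A u w × A v w

  HasNeighbourIn : (V → Set) → V → Set
  HasNeighbourIn Φ u = ∃ λ v → A u v × Φ v

module _ {V : Set} {A : Rel V 0ℓ} where

  ¬-invariant : ∀ {Φ} → Invariant A Φ → Invariant A (¬_ ∘ Φ)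
  ¬-invariant {Φ} inv σ u ¬Φu Φσu = ¬Φu (subst Φ (unapply-apply σ u) (inv (inverseAut σ) _ Φσu))

  dominating-invariant : Invariant A (Dominating A)
  dominating-invariant σ u dom v σu≢v =
    subst (A (apply σ u)) (apply-unapply σ v)
      (Aut.preserves σ _ _ (dom _ λ u≡ → σu≢v (trans (cong (apply σ) u≡) (apply-unapply σ v))))

  inTriangle-invariant : Invariant A (InTriangle A)
  inTriangle-invariant σ u (v , w , uv , uw , vw) =
    apply σ v , apply σ w , Aut.preserves σ _ _ uv , Aut.preserves σ _ _ uw , Aut.preserves σ _ _ vw

  hasNeighbourIn-invariant : ∀ {Φ} → Invariant A Φ → Invariant A (HasNeighbourIn A Φ)
  hasNeighbourIn-invariant inv σ u (v , uv , Φv) = apply σ v , Aut.preserves σ _ _ uv , inv σ v Φv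

invariant⇒keepsLeft : ∀ {P Q} {B : Rel (P ⊎ Q) 0ℓ} {Φ} → Invariant B Φ →
  (∀ p → Φ (inj₁ p)) → (∀ q → ¬ Φ (inj₂ q)) → KeepsLeft B
invariant⇒keepsLeft inv left right σ p with apply σ (inj₁ p) | inv σ (inj₁ p) (left p)
... | inj₁ p' | _ = p' , refl
... | inj₂ q | Φq = ⊥-elim (right q Φq)

-- Model graphs

xor-cancelʳ : ∀ a b → (a xor b) xor b ≡ a
xor-cancelʳ a b = trans (xor-assoc a b b) (trans (cong (a xor_) (xor-same b)) (xor-identityʳ a))

xor-cancel-both : ∀ a b h → (a xor h) xor (b xor h) ≡ a xor b
xor-cancel-both false false false = refl
xor-cancel-both false false true = refl
xor-cancel-both false true false = refl
xor-cancel-both false true true = refl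
xor-cancel-both true false false = refl
xor-cancel-both true false true = refl
xor-cancel-both true true false = refl
xor-cancel-both true true true = refl

component : {A : Set} → Bool → A × A → A
component false = proj₁
component true = proj₂

component-⋊ : ∀ {P : Set} s h (α β : Perm P × Perm P) x →
  let SD = SemidirectProduct (PermGroup P ×ᴳ PermGroup P) C₂ (swapAction (PermGroup P)) in
  Inverse.to (component s (proj₁ (Group._∙_ SD (α , h) (β , h)))) x
    ≡ Inverse.to (component s α) (Inverse.to (component (s xor h) β) x)
component-⋊ false false α β x = refl
component-⋊ false true α β x = refl
component-⋊ true false α β x = refl
component-⋊ true true α β x = refl

CompleteBipartite : (P : Set) → Rel (Bool × P) 0ℓ
CompleteBipartite P = BlockGraph proj₁ _xor_

module _ {P : Set} (p₀ : P) where

  private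
    V = Bool × P
    K = CompleteBipartite P
    _∙_ = Group._∙_ (AutGroup V K)
    SD = SemidirectProduct (PermGroup P ×ᴳ PermGroup P) C₂ (swapAction (PermGroup P))
    module SD = Group SD

    onSide : ∀ {s : Bool} (w : V) → proj₁ w ≡ s → w ≡ (s , proj₂ w)
    onSide w refl = refl

    sides-differ⇒adjacent : ∀ u v → T (proj₁ u xor proj₁ v) → K u v
    sides-differ⇒adjacent u v t = (λ { refl → subst T (xor-same (proj₁ u)) t }) , t

  xor-invariant : ∀ (σ : Aut V K) u v → proj₁ (apply σ u) xor proj₁ (apply σ v) ≡ proj₁ u xor proj₁ v
  xor-invariant σ u v with proj₁ u xor proj₁ v in uv | proj₁ (apply σ u) xor proj₁ (apply σ v) in σuv
  ... | true | true = refl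
  ... | false | false = refl
  ... | true | false =
    ⊥-elim (subst T σuv (proj₂ (Aut.preserves σ u v (sides-differ⇒adjacent u v (subst T (sym uv) tt)))))
  ... | false | true =
    ⊥-elim (subst T uv (proj₂ (Aut.reflects σ u v (sides-differ⇒adjacent _ _ (subst T (sym σuv) tt)))))

  -- σ swaps the two sides iff flips σ; halfPerm σ s is σ restricted to side s xor flips σ,
  -- which σ maps onto side s.
  flips : Aut V K → Bool
  flips σ = proj₁ (apply σ (false , p₀))

  side-apply : ∀ σ u → proj₁ (apply σ u) ≡ proj₁ u xor flips σ
  side-apply σ u = begin
    proj₁ (apply σ u)                               ≡⟨ xor-cancelʳ _ (flips σ) ⟨
    (proj₁ (apply σ u) xor flips σ) xor flips σ     ≡⟨ cong (_xor flips σ) (xor-invariant σ u (false , p₀)) ⟩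
    (proj₁ u xor false) xor flips σ                 ≡⟨ cong (_xor flips σ) (xor-identityʳ (proj₁ u)) ⟩
    proj₁ u xor flips σ                             ∎
    where open ≡-Reasoning

  side-unapply : ∀ σ w → proj₁ (unapply σ w) ≡ proj₁ w xor flips σ
  side-unapply σ w = begin
    proj₁ (unapply σ w)                                   ≡⟨ xor-cancelʳ _ (flips σ) ⟨
    (proj₁ (unapply σ w) xor flips σ) xor flips σ         ≡⟨ cong (_xor flips σ) (side-apply σ (unapply σ w)) ⟨
    proj₁ (apply σ (unapply σ w)) xor flips σ             ≡⟨ cong (λ w' → proj₁ w' xor flips σ) (apply-unapply σ w) ⟩
    proj₁ w xor flips σ                                   ∎
    where open ≡-Reasoning

  flips-homo : ∀ σ τ → flips (σ ∙ τ) ≡ flips σ xor flips τ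
  flips-homo σ τ = trans (side-apply σ _) (xor-comm (flips τ) (flips σ))

  halfPerm : Aut V K → Bool → Perm P
  halfPerm σ s = restrict (Aut.perm σ) (s xor flips σ ,_) (s ,_) ,-injectiveʳ ,-injectiveʳ
    (λ x → proj₂ (apply σ (s xor flips σ , x)) , onSide _ (trans (side-apply σ _) (xor-cancelʳ s (flips σ))))
    (λ y → proj₂ (unapply σ (s , y)) , onSide _ (side-unapply σ _))

  apply-halfPerm : ∀ σ s x → apply σ (s xor flips σ , x) ≡ (s , Inverse.to (halfPerm σ s) x)
  apply-halfPerm σ s x = onSide _ (trans (side-apply σ _) (xor-cancelʳ s (flips σ)))

  halves : Aut V K → Perm P × Perm P
  halves σ = halfPerm σ false , halfPerm σ true

  component-halves : ∀ σ s → component s (halves σ) ≡ halfPerm σ s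
  component-halves σ false = refl
  component-halves σ true = refl

  halves-≈ : ∀ σ (αs : Perm P × Perm P) →
    (∀ s x → Inverse.to (halfPerm σ s) x ≡ Inverse.to (component s αs) x) →
    Group._≈_ (PermGroup P ×ᴳ PermGroup P) (halves σ) αs
  halves-≈ σ αs eq = eq false , eq true

  fromSD : SD.Carrier → Aut V K
  fromSD (αs , h) = mkAut perm adjacency
    where
    α : Bool → Perm P
    α s = component s αs
    retract : ∀ {s x} t → t ≡ s → (t , Inverse.to (α t) (Inverse.from (α s) x)) ≡ (s , x)
    retract {s} t refl = cong (s ,_) (Inverse.strictlyInverseˡ (α s) _)
    perm : Perm V
    perm = mk↔ₛ′ (λ (s , x) → s xor h , Inverse.to (α (s xor h)) x)
                 (λ (s , x) → s xor h , Inverse.from (α s) x)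
                 (λ (s , x) → retract _ (xor-cancelʳ s h))
                 (λ (s , x) → cong₂ _,_ (xor-cancelʳ s h) (Inverse.strictlyInverseʳ (α (s xor h)) x))
    adjacency : ∀ u v → K u v ⇔ K (Inverse.to perm u) (Inverse.to perm v)
    adjacency u v = mk⇔
      (λ (u≢v , t) → u≢v ∘ ↔-injective perm , subst T (sym (xor-cancel-both (proj₁ u) (proj₁ v) h)) t)
      (λ (u≢v , t) → u≢v ∘ cong (Inverse.to perm) , subst T (xor-cancel-both (proj₁ u) (proj₁ v) h) t)

  Aut-CompleteBipartite≃ :
    AutGroup (Bool × P) (CompleteBipartite P)
      ≃ᴳ SemidirectProduct (PermGroup P ×ᴳ PermGroup P) C₂ (swapAction (PermGroup P))
  Aut-CompleteBipartite≃ = record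
    { to = λ σ → halves σ , flips σ
    ; from = fromSD
    ; to-cong = λ {σ} {τ} σ≈τ →
        halves-≈ σ (halves τ) (λ s x → trans
          (cong proj₂ (trans (cong (λ f → apply σ (s xor f , x)) (cong proj₁ (σ≈τ (false , p₀)))) (σ≈τ _)))
          (cong (λ π → Inverse.to π x) (sym (component-halves τ s))))
      , cong proj₁ (σ≈τ (false , p₀))
    ; from-cong = fromSD-cong
    ; homo = λ σ τ → halves-≈ (σ ∙ τ) _ (λ s x → ,-injectiveʳ (begin
          (s , Inverse.to (halfPerm (σ ∙ τ) s) x)
            ≡⟨ apply-halfPerm (σ ∙ τ) s x ⟨
          apply (σ ∙ τ) (s xor flips (σ ∙ τ) , x)
            ≡⟨ cong (λ f → apply (σ ∙ τ) (f , x)) (trans (cong (s xor_) (flips-homo σ τ)) (sym (xor-assoc s _ _))) ⟩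
          apply σ (apply τ ((s xor flips σ) xor flips τ , x))
            ≡⟨ cong (apply σ) (apply-halfPerm τ (s xor flips σ) x) ⟩
          apply σ (s xor flips σ , Inverse.to (halfPerm τ (s xor flips σ)) x)
            ≡⟨ apply-halfPerm σ s _ ⟩
          (s , Inverse.to (halfPerm σ s) (Inverse.to (halfPerm τ (s xor flips σ)) x))
            ≡⟨ cong₂ (λ π π' → s , Inverse.to π (Inverse.to π' x))
                 (component-halves σ s) (component-halves τ (s xor flips σ)) ⟨
          (s , Inverse.to (component s (halves σ)) (Inverse.to (component (s xor flips σ) (halves τ)) x))
            ≡⟨ cong (s ,_) (component-⋊ s (flips σ) (halves σ) (halves τ) x) ⟨
          (s , Inverse.to (component s (proj₁ ((halves σ , flips σ) SD.∙ (halves τ , flips σ)))) x)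
            ∎))
      , flips-homo σ τ
    ; to-from = λ (αs , h) → halves-≈ (fromSD (αs , h)) αs (λ s x →
        cong (λ t → Inverse.to (component t αs) x) (xor-cancelʳ s h))
      , refl
    ; from-to = λ σ (s , x) → sym (begin
        apply σ (s , x)
          ≡⟨ cong (λ t → apply σ (t , x)) (xor-cancelʳ s (flips σ)) ⟨
        apply σ ((s xor flips σ) xor flips σ , x)
          ≡⟨ apply-halfPerm σ (s xor flips σ) x ⟩
        (s xor flips σ , Inverse.to (halfPerm σ (s xor flips σ)) x)
          ≡⟨ cong (λ π → s xor flips σ , Inverse.to π x) (component-halves σ (s xor flips σ)) ⟨
        (s xor flips σ , Inverse.to (component (s xor flips σ) (halves σ)) x) ∎) }
    where
    open ≡-Reasoning
    component-≈ : ∀ {α₀ α₁ β₀ β₁ : Perm P} → (∀ x → Inverse.to α₀ x ≡ Inverse.to β₀ x) →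
      (∀ x → Inverse.to α₁ x ≡ Inverse.to β₁ x) →
      ∀ s x → Inverse.to (component s (α₀ , α₁)) x ≡ Inverse.to (component s (β₀ , β₁)) x
    component-≈ eq₀ eq₁ false = eq₀
    component-≈ eq₀ eq₁ true = eq₁
    fromSD-cong : ∀ {a b} → a SD.≈ b → Group._≈_ (AutGroup V K) (fromSD a) (fromSD b)
    fromSD-cong {αs , h} {βs , .h} ((eq₀ , eq₁) , refl) (s , x) =
      cong (s xor h ,_) (component-≈ eq₀ eq₁ (s xor h) x)

inRight : {A B : Set} → A ⊎ B → Bool
inRight (inj₁ _) = false
inRight (inj₂ _) = true

Nontrivial : Set → Set
Nontrivial P = ∀ (p : P) → ∃ λ p' → p ≢ p'

-- inj₁ is an independent set, inj₂ a clique, and all edges between them are present.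
IndependentJoinClique : (P Q : Set) → Rel (P ⊎ Q) 0ℓ
IndependentJoinClique P Q = BlockGraph inRight _∨_

module _ {P Q : Set} (nontrivial : Nontrivial P) where

  private
    B = IndependentJoinClique P Q

    inj₂-dominating : ∀ q → Dominating B (inj₂ q)
    inj₂-dominating q (inj₁ p) _ = (λ ()) , tt
    inj₂-dominating q (inj₂ q') q≢q' = q≢q' , tt

    inj₁-not-dominating : ∀ p → ¬ Dominating B (inj₁ p)
    inj₁-not-dominating p dominating with nontrivial p
    ... | p' , p≢p' = proj₂ (dominating (inj₁ p') (p≢p' ∘ inj₁-injective))

    cross : ∀ p q → B (inj₁ p) (inj₂ q) ⇔ ⊤
    cross p q = mk⇔ _ λ _ → (λ ()) , tt

    cross' : ∀ p q → B (inj₂ q) (inj₁ p) ⇔ ⊤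
    cross' p q = mk⇔ _ λ _ → (λ ()) , tt

  Aut-IndependentJoinClique≃ : AutGroup (P ⊎ Q) (IndependentJoinClique P Q) ≃ᴳ (PermGroup P ×ᴳ PermGroup Q)
  Aut-IndependentJoinClique≃ = ≃ᴳ-trans
    (Aut⊎≃× ⊤ cross cross'
      (invariant⇒keepsLeft (¬-invariant dominating-invariant) inj₁-not-dominating (λ q ¬dom → ¬dom (inj₂-dominating q))))
    (×ᴳ-cong (Aut≃Perm (distinctOn-permutationInvariant inj₁ inj₁-injective ⊥))
             (Aut≃Perm (distinctOn-permutationInvariant inj₂ inj₂-injective ⊤)))

IndependentJoinClique-diameter≤2 : ∀ {P Q} → P → Q → Diameter≤2 (IndependentJoinClique P Q)
IndependentJoinClique-diameter≤2 p₀ q₀ (inj₁ _) (inj₁ _) = inj₂ (inj₂ (inj₂ q₀ , ((λ ()) , tt) , ((λ ()) , tt)))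
IndependentJoinClique-diameter≤2 p₀ q₀ (inj₁ _) (inj₂ _) = inj₂ (inj₁ ((λ ()) , tt))
IndependentJoinClique-diameter≤2 p₀ q₀ (inj₂ _) (inj₁ _) = inj₂ (inj₁ ((λ ()) , tt))
IndependentJoinClique-diameter≤2 p₀ q₀ (inj₂ _) (inj₂ _) = inj₂ (inj₂ (inj₁ p₀ , ((λ ()) , tt) , ((λ ()) , tt)))

threeBlocks : {A B C : Set} → A ⊎ (B ⊎ C) → Fin 3
threeBlocks (inj₁ _) = zero
threeBlocks (inj₂ (inj₁ _)) = suc zero
threeBlocks (inj₂ (inj₂ _)) = suc (suc zero)

-- Block 0 is an independent set joined to everything else; block 1 is a clique, block 2 an
-- independent set, and there are no edges between blocks 1 and 2.
independentJoinCliquePlusIndependentTable : Fin 3 → Fin 3 → Bool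
independentJoinCliquePlusIndependentTable zero zero = false
independentJoinCliquePlusIndependentTable zero (suc _) = true
independentJoinCliquePlusIndependentTable (suc _) zero = true
independentJoinCliquePlusIndependentTable (suc zero) (suc zero) = true
independentJoinCliquePlusIndependentTable (suc zero) (suc (suc zero)) = false
independentJoinCliquePlusIndependentTable (suc (suc zero)) (suc _) = false

IndependentJoinCliquePlusIndependent : (P P' Q : Set) → Rel (P ⊎ (P' ⊎ Q)) 0ℓ
IndependentJoinCliquePlusIndependent P P' Q = BlockGraph threeBlocks independentJoinCliquePlusIndependentTable

module _ {P P' Q : Set} (p₀ : P) (p'₀ : P') (nontrivial : Nontrivial P') (q₀ : Q) where

  private
    B = IndependentJoinCliquePlusIndependent P P' Q
    B' = B on inj₂

    other-p' = proj₁ (nontrivial p'₀)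
    p'₀≢other = proj₂ (nontrivial p'₀)

    inj₁-inTriangle : ∀ p → InTriangle B (inj₁ p)
    inj₁-inTriangle p = inj₂ (inj₁ p'₀) , inj₂ (inj₁ other-p') , ((λ ()) , tt) , ((λ ()) , tt)
                      , (p'₀≢other ∘ inj₁-injective ∘ inj₂-injective) , tt

    clique-inTriangle : ∀ x → InTriangle B (inj₂ (inj₁ x))
    clique-inTriangle x with nontrivial x
    ... | x' , x≢x' = inj₂ (inj₁ x') , inj₁ p₀ , ((x≢x' ∘ inj₁-injective ∘ inj₂-injective) , tt)
                    , ((λ ()) , tt) , ((λ ()) , tt)

    independent-notInTriangle : ∀ q → ¬ InTriangle B (inj₂ (inj₂ q))
    independent-notInTriangle q (inj₁ v , inj₁ w , _ , _ , (_ , ()))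
    independent-notInTriangle q (inj₁ v , inj₂ (inj₁ w) , _ , (_ , ()) , _)
    independent-notInTriangle q (inj₁ v , inj₂ (inj₂ w) , _ , (_ , ()) , _)
    independent-notInTriangle q (inj₂ (inj₁ v) , _ , (_ , ()) , _)
    independent-notInTriangle q (inj₂ (inj₂ v) , _ , (_ , ()) , _)

    HasTriangleFreeNeighbour = HasNeighbourIn B (¬_ ∘ InTriangle B)

    inj₁-hasTriangleFreeNeighbour : ∀ p → HasTriangleFreeNeighbour (inj₁ p)
    inj₁-hasTriangleFreeNeighbour p = inj₂ (inj₂ q₀) , ((λ ()) , tt) , independent-notInTriangle q₀

    inj₂-noTriangleFreeNeighbour : ∀ w → ¬ HasTriangleFreeNeighbour (inj₂ w)
    inj₂-noTriangleFreeNeighbour w (inj₁ v , _ , notInTriangle) = notInTriangle (inj₁-inTriangle v)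
    inj₂-noTriangleFreeNeighbour w (inj₂ (inj₁ v) , _ , notInTriangle) = notInTriangle (clique-inTriangle v)
    inj₂-noTriangleFreeNeighbour (inj₁ w) (inj₂ (inj₂ v) , (_ , ()) , _)
    inj₂-noTriangleFreeNeighbour (inj₂ w) (inj₂ (inj₂ v) , (_ , ()) , _)

    clique-hasNeighbour : ∀ x → HasNeighbourIn B' (λ _ → ⊤) (inj₁ x)
    clique-hasNeighbour x with nontrivial x
    ... | x' , x≢x' = inj₁ x' , ((x≢x' ∘ inj₁-injective ∘ inj₂-injective) , tt) , tt

    independent-noNeighbour : ∀ q → ¬ HasNeighbourIn B' (λ _ → ⊤) (inj₂ q)
    independent-noNeighbour q (inj₁ v , (_ , ()) , _)
    independent-noNeighbour q (inj₂ v , (_ , ()) , _)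

    Aut-CliquePlusIndependent≃ : AutGroup (P' ⊎ Q) B' ≃ᴳ (PermGroup P' ×ᴳ PermGroup Q)
    Aut-CliquePlusIndependent≃ = ≃ᴳ-trans
      (Aut⊎≃× ⊥ (λ _ _ → mk⇔ proj₂ λ ()) (λ _ _ → mk⇔ proj₂ λ ())
        (invariant⇒keepsLeft (hasNeighbourIn-invariant λ _ _ _ → tt) clique-hasNeighbour independent-noNeighbour))
      (×ᴳ-cong (Aut≃Perm (distinctOn-permutationInvariant (inj₂ ∘ inj₁) (inj₁-injective ∘ inj₂-injective) ⊤))
               (Aut≃Perm (distinctOn-permutationInvariant (inj₂ ∘ inj₂) (inj₂-injective ∘ inj₂-injective) ⊥)))

  Aut-IndependentJoinCliquePlusIndependent≃ :
    AutGroup (P ⊎ (P' ⊎ Q)) (IndependentJoinCliquePlusIndependent P P' Q)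
      ≃ᴳ (PermGroup P ×ᴳ (PermGroup P' ×ᴳ PermGroup Q))
  Aut-IndependentJoinCliquePlusIndependent≃ = ≃ᴳ-trans
    (Aut⊎≃× ⊤ cross cross'
      (invariant⇒keepsLeft (hasNeighbourIn-invariant (¬-invariant inTriangle-invariant))
        inj₁-hasTriangleFreeNeighbour inj₂-noTriangleFreeNeighbour))
    (×ᴳ-cong (Aut≃Perm (distinctOn-permutationInvariant inj₁ inj₁-injective ⊥)) Aut-CliquePlusIndependent≃)
    where
    cross : ∀ p w → B (inj₁ p) (inj₂ w) ⇔ ⊤
    cross p (inj₁ _) = mk⇔ _ λ _ → (λ ()) , tt
    cross p (inj₂ _) = mk⇔ _ λ _ → (λ ()) , tt
    cross' : ∀ p w → B (inj₂ w) (inj₁ p) ⇔ ⊤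
    cross' p (inj₁ _) = mk⇔ _ λ _ → (λ ()) , tt
    cross' p (inj₂ _) = mk⇔ _ λ _ → (λ ()) , tt

-- Zero-divisor graphs of integer multiples of fixed matrices

scaleR : (d : ℕ) → ℤ → R d → R d
scaleR zero c x = c ℤ.* x
scaleR (suc k) c (x , y) = c ℤ.* x , c ℤ.* y

fromℤ-*R : ∀ d c x → fromℤ d c *R x ≡ scaleR d c x
fromℤ-*R zero c x = refl
fromℤ-*R (suc k) c (a , b) with suc k ℕ.% 4 ℕ.≟ 3
... | yes _ = cong₂ _,_ (re c a b (+ ((suc k ℕ.+ 1) ℕ./ 4))) (im c a b)
  where
  re : ∀ c a b K → c ℤ.* a ℤ.- K ℤ.* (+ 0 ℤ.* b) ≡ c ℤ.* a
  re = solve-∀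
  im : ∀ c a b → c ℤ.* b ℤ.+ + 0 ℤ.* a ℤ.+ + 0 ℤ.* b ≡ c ℤ.* b
  im = solve-∀
... | no _ = cong₂ _,_ (re c a b (+ suc k)) (im c a b)
  where
  re : ∀ c a b K → c ℤ.* a ℤ.- K ℤ.* (+ 0 ℤ.* b) ≡ c ℤ.* a
  re = solve-∀
  im : ∀ c a b → c ℤ.* b ℤ.+ + 0 ℤ.* a ≡ c ℤ.* b
  im = solve-∀

scaleR-*R : ∀ d c c' x y → scaleR d c x *R scaleR d c' y ≡ scaleR d c (scaleR d c' (x *R y))
scaleR-*R zero c c' x y = lemma c c' x y
  where
  lemma : ∀ c c' x y → (c ℤ.* x) ℤ.* (c' ℤ.* y) ≡ c ℤ.* (c' ℤ.* (x ℤ.* y))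
  lemma = solve-∀
scaleR-*R (suc k) c c' (a , b) (a' , b') with suc k ℕ.% 4 ℕ.≟ 3
... | yes _ = cong₂ _,_ (re c c' a b a' b' (+ ((suc k ℕ.+ 1) ℕ./ 4))) (im c c' a b a' b')
  where
  re : ∀ c c' a b a' b' K → (c ℤ.* a) ℤ.* (c' ℤ.* a') ℤ.- K ℤ.* ((c ℤ.* b) ℤ.* (c' ℤ.* b'))
                          ≡ c ℤ.* (c' ℤ.* (a ℤ.* a' ℤ.- K ℤ.* (b ℤ.* b')))
  re = solve-∀
  im : ∀ c c' a b a' b' → (c ℤ.* a) ℤ.* (c' ℤ.* b') ℤ.+ (c ℤ.* b) ℤ.* (c' ℤ.* a') ℤ.+ (c ℤ.* b) ℤ.* (c' ℤ.* b')
                        ≡ c ℤ.* (c' ℤ.* (a ℤ.* b' ℤ.+ b ℤ.* a' ℤ.+ b ℤ.* b'))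
  im = solve-∀
... | no _ = cong₂ _,_ (re c c' a b a' b' (+ suc k)) (im c c' a b a' b')
  where
  re : ∀ c c' a b a' b' K → (c ℤ.* a) ℤ.* (c' ℤ.* a') ℤ.- K ℤ.* ((c ℤ.* b) ℤ.* (c' ℤ.* b'))
                          ≡ c ℤ.* (c' ℤ.* (a ℤ.* a' ℤ.- K ℤ.* (b ℤ.* b')))
  re = solve-∀
  im : ∀ c c' a b a' b' → (c ℤ.* a) ℤ.* (c' ℤ.* b') ℤ.+ (c ℤ.* b) ℤ.* (c' ℤ.* a')
                        ≡ c ℤ.* (c' ℤ.* (a ℤ.* b' ℤ.+ b ℤ.* a'))
  im = solve-∀

scaleR-+R : ∀ d c x y → scaleR d c x +R scaleR d c y ≡ scaleR d c (x +R y)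
scaleR-+R zero c x y = sym (ℤ.*-distribˡ-+ c x y)
scaleR-+R (suc k) c (a , b) (a' , b') = cong₂ _,_ (sym (ℤ.*-distribˡ-+ c a a')) (sym (ℤ.*-distribˡ-+ c b b'))

scaleR-0R : ∀ d c → scaleR d c (0R d) ≡ 0R d
scaleR-0R zero c = ℤ.*-zeroʳ c
scaleR-0R (suc k) c = cong₂ _,_ (ℤ.*-zeroʳ c) (ℤ.*-zeroʳ c)

scaleR-cancel : ∀ d c x .{{_ : ℤ.NonZero c}} → scaleR d c x ≡ 0R d → x ≡ 0R d
scaleR-cancel zero c x eq = ℤ.*-cancelˡ-≡ c x (+ 0) (trans eq (sym (ℤ.*-zeroʳ c)))
scaleR-cancel (suc k) c (a , b) eq = cong₂ _,_
  (ℤ.*-cancelˡ-≡ c a (+ 0) (trans (cong proj₁ eq) (sym (ℤ.*-zeroʳ c))))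
  (ℤ.*-cancelˡ-≡ c b (+ 0) (trans (cong proj₂ eq) (sym (ℤ.*-zeroʳ c))))

mat-cong : ∀ {d} {a a' b b' c c' e e' : R d} → a ≡ a' → b ≡ b' → c ≡ c' → e ≡ e' → mat a b c e ≡ mat a' b' c' e'
mat-cong refl refl refl refl = refl

scaleM : (d : ℕ) → ℤ → M₂ d → M₂ d
scaleM d c (mat a b e f) = mat (scaleR d c a) (scaleR d c b) (scaleR d c e) (scaleR d c f)

•M≡scaleM : ∀ d c X → c •M X ≡ scaleM d c X
•M≡scaleM d c (mat a b e f) = mat-cong (fromℤ-*R d c a) (fromℤ-*R d c b) (fromℤ-*R d c e) (fromℤ-*R d c f)

scaleM-·M : ∀ d c c' X Y → scaleM d c X ·M scaleM d c' Y ≡ scaleM d c (scaleM d c' (X ·M Y))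
scaleM-·M d c c' (mat a b e f) (mat a' b' e' f') =
  mat-cong (entry a b a' e') (entry a b b' f') (entry e f a' e') (entry e f b' f')
  where
  entry : ∀ x y z w → scaleR d c x *R scaleR d c' z +R scaleR d c y *R scaleR d c' w
                    ≡ scaleR d c (scaleR d c' (x *R z +R y *R w))
  entry x y z w = trans (cong₂ _+R_ (scaleR-*R d c c' x z) (scaleR-*R d c c' y w))
                        (trans (scaleR-+R d c _ _) (cong (scaleR d c) (scaleR-+R d c' _ _)))

scaleM-0M : ∀ d c → scaleM d c (0M d) ≡ 0M d
scaleM-0M d c = mat-cong (scaleR-0R d c) (scaleR-0R d c) (scaleR-0R d c) (scaleR-0R d c)

scaleM-cancel : ∀ d c X .{{_ : ℤ.NonZero c}} → scaleM d c X ≡ 0M d → X ≡ 0M d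
scaleM-cancel d c (mat a b e f) eq = mat-cong
  (scaleR-cancel d c a (cong M₂.m11 eq)) (scaleR-cancel d c b (cong M₂.m12 eq))
  (scaleR-cancel d c e (cong M₂.m21 eq)) (scaleR-cancel d c f (cong M₂.m22 eq))

•M-·M-zero⇔ : ∀ d c c' X Y .{{_ : ℤ.NonZero c}} .{{_ : ℤ.NonZero c'}} →
  (c •M X) ·M (c' •M Y) ≡ 0M d ⇔ X ·M Y ≡ 0M d
•M-·M-zero⇔ d c c' X Y = mk⇔
  (λ eq → scaleM-cancel d c' _ (scaleM-cancel d c _ (trans (sym product) eq)))
  (λ eq → trans product (trans (cong (scaleM d c ∘ scaleM d c') eq)
                        (trans (cong (scaleM d c) (scaleM-0M d c')) (scaleM-0M d c))))
  where
  product : (c •M X) ·M (c' •M Y) ≡ scaleM d c (scaleM d c' (X ·M Y))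
  product = trans (cong₂ _·M_ (•M≡scaleM d c X) (•M≡scaleM d c' Y)) (scaleM-·M d c c' X Y)

_≟R_ : ∀ {d} → DecidableEquality (R d)
_≟R_ {zero} = ℤ._≟_
_≟R_ {suc k} = ≡-dec ℤ._≟_ ℤ._≟_

infix 4 _≟R_ _≟M_

_≟M_ : ∀ {d} → DecidableEquality (M₂ d)
X ≟M Y = map′ (fromEntries X Y) (cong entries) (≡-dec _≟R_ (≡-dec _≟R_ (≡-dec _≟R_ _≟R_)) (entries X) (entries Y))
  where
  entries : ∀ {d} → M₂ d → R d × R d × R d × R d
  entries (mat a b c e) = a , b , c , e
  fromEntries : ∀ {d} (X Y : M₂ d) → entries X ≡ entries Y → X ≡ Y
  fromEntries (mat _ _ _ _) (mat _ _ _ _) refl = refl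

ZeroDivisorTable : ∀ {d} {K : Set} → (K → M₂ d) → K → K → Bool
ZeroDivisorTable {d} B i j = isYes (B i ·M B j ≟M 0M d) ∨ isYes (B j ·M B i ≟M 0M d)

T-ZeroDivisorTable : ∀ {d K} (B : K → M₂ d) i j →
  T (ZeroDivisorTable B i j) ⇔ (B i ·M B j ≡ 0M d ⊎ B j ·M B i ≡ 0M d)
T-ZeroDivisorTable {d} B i j = (T-isYes (B i ·M B j ≟M 0M d) ⊎-⇔ T-isYes (B j ·M B i ≟M 0M d)) ⇔-∘ T-∨
  where
  T-isYes : ∀ {A : Set} (a? : Dec A) → T (isYes a?) ⇔ A
  T-isYes a? = mk⇔ (toWitness {a? = a?}) (fromWitness {a? = a?})

-- With from-yes, agreement of two finite tables is checked by evaluation.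
tablesAgree? : ∀ {k} (t t' : Fin k → Fin k → Bool) → Dec (∀ i j → t i j ≡ t' i j)
tablesAgree? t t' = Fin.all? λ i → Fin.all? λ j → t i j Bool.≟ t' i j

ZAdj-multiples⇔BlockGraph : ∀ {d V K} (B : K → M₂ d) (blk : V → K) (coefficient : V → ℤ) (M : V → M₂ d) →
  (∀ u → ℤ.NonZero (coefficient u)) → (∀ u → M u ≡ coefficient u •M B (blk u)) →
  ∀ u v → ZAdj M u v ⇔ BlockGraph blk (ZeroDivisorTable B) u v
ZAdj-multiples⇔BlockGraph {d} B blk coefficient M nonZero M≡ u v =
  ⇔-id _ ×-⇔ (⇔-sym (T-ZeroDivisorTable B (blk u) (blk v)) ⇔-∘ (product-zero⇔ u v ⊎-⇔ product-zero⇔ v u))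
  where
  product-zero⇔ : ∀ u v → M u ·M M v ≡ 0M d ⇔ B (blk u) ·M B (blk v) ≡ 0M d
  product-zero⇔ u v =
    •M-·M-zero⇔ d (coefficient u) (coefficient v) _ _ {{nonZero u}} {{nonZero v}}
    ⇔-∘ ≡⇒⇔ (λ X Y → X ·M Y ≡ 0M d) (M≡ u) (M≡ v)

ZAdj-cong : ∀ {d V} {M M' : V → M₂ d} → (∀ u → M u ≡ M' u) → ∀ u v → ZAdj M u v ⇔ ZAdj M' u v
ZAdj-cong {d} M≡M' u v = ⇔-id _ ×-⇔ (≡⇒⇔ Z (M≡M' u) (M≡M' v) ⊎-⇔ ≡⇒⇔ Z (M≡M' v) (M≡M' u))
  where
  Z : Rel (M₂ d) 0ℓ
  Z X Y = X ·M Y ≡ 0M d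

fromM : (d : ℕ) → M₂ 0 → M₂ d
fromM d (mat a b c e) = mat (fromℤ d a) (fromℤ d b) (fromℤ d c) (fromℤ d e)

fromℤ-*R-fromℤ : ∀ d a b → fromℤ d a *R fromℤ d b ≡ fromℤ d (a ℤ.* b)
fromℤ-*R-fromℤ zero a b = refl
fromℤ-*R-fromℤ (suc k) a b = trans (fromℤ-*R (suc k) a (b , + 0)) (cong (a ℤ.* b ,_) (ℤ.*-zeroʳ a))

fromℤ-+R-fromℤ : ∀ d a b → fromℤ d a +R fromℤ d b ≡ fromℤ d (a ℤ.+ b)
fromℤ-+R-fromℤ zero a b = refl
fromℤ-+R-fromℤ (suc k) a b = refl

fromℤ-injective : ∀ d {a b} → fromℤ d a ≡ fromℤ d b → a ≡ b
fromℤ-injective zero eq = eq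
fromℤ-injective (suc k) eq = cong proj₁ eq

fromM-·M : ∀ d X Y → fromM d X ·M fromM d Y ≡ fromM d (X ·M Y)
fromM-·M d (mat a b c e) (mat a' b' c' e') =
  mat-cong (entry a b a' c') (entry a b b' e') (entry c e a' c') (entry c e b' e')
  where
  entry : ∀ x y z w → fromℤ d x *R fromℤ d z +R fromℤ d y *R fromℤ d w ≡ fromℤ d (x ℤ.* z ℤ.+ y ℤ.* w)
  entry x y z w = trans (cong₂ _+R_ (fromℤ-*R-fromℤ d x z) (fromℤ-*R-fromℤ d y w)) (fromℤ-+R-fromℤ d _ _)

fromM-injective : ∀ d {X Y} → fromM d X ≡ fromM d Y → X ≡ Y
fromM-injective d {mat _ _ _ _} {mat _ _ _ _} eq = mat-cong
  (fromℤ-injective d (cong M₂.m11 eq)) (fromℤ-injective d (cong M₂.m12 eq))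
  (fromℤ-injective d (cong M₂.m21 eq)) (fromℤ-injective d (cong M₂.m22 eq))

•M-fromM : ∀ d c X → c •M fromM d X ≡ fromM d (c •M X)
•M-fromM d c (mat a b e f) =
  mat-cong (fromℤ-*R-fromℤ d c a) (fromℤ-*R-fromℤ d c b) (fromℤ-*R-fromℤ d c e) (fromℤ-*R-fromℤ d c f)

Aₜ-fromℤ : ∀ d t → Aₜ (fromℤ d t) ≡ fromM d (Aₜ t)
Aₜ-fromℤ d t = mat-cong refl refl (fromℤ-*R-fromℤ d t t)
  (trans (cong (fromℤ d t *R_) (fromℤ-*R-fromℤ d t t)) (fromℤ-*R-fromℤ d t (t ℤ.* t)))

ZAdj-fromM⇔ : ∀ d {V} (M : V → M₂ 0) u v → ZAdj (fromM d ∘ M) u v ⇔ ZAdj M u v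
ZAdj-fromM⇔ d M u v = ⇔-id _ ×-⇔ (product-zero⇔ u v ⊎-⇔ product-zero⇔ v u)
  where
  product-zero⇔ : ∀ u v → fromM d (M u) ·M fromM d (M v) ≡ 0M d ⇔ M u ·M M v ≡ 0M 0
  product-zero⇔ u v = mk⇔
    (λ eq → fromM-injective d (trans (sym (fromM-·M d (M u) (M v))) eq))
    (λ eq → trans (fromM-·M d (M u) (M v)) (cong (fromM d) eq))

mat₁≡fromM : ∀ d n u → mat₁ d n u ≡ fromM d (mat₁ 0 n u)
mat₁≡fromM d n (inj₁ l) = trans (cong (coef l •M_) (Aₜ-fromℤ d (+ 0))) (•M-fromM d (coef l) _)
mat₁≡fromM d n (inj₂ l) = refl

G₁≃G₁-over-ℤ : ∀ d n → G₁ d n ≃ᴳ G₁ 0 n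
G₁≃G₁-over-ℤ d n = Aut-cong (↔-id _) λ u v → ZAdj-fromM⇔ d (mat₁ 0 n) u v ⇔-∘ ZAdj-cong (mat₁≡fromM d n) u v

±1 : (d : ℕ) → List (R d)
±1 d = 1R d ∷ fromℤ d (- + 1) ∷ []

mat±1 : (d n : ℕ) → Fin 2 × Coef n → M₂ d
mat±1 d n (j , l) = coef l •M Aₜ (lookup (±1 d) j)

mat±1≡fromM : ∀ d n u → mat±1 d n u ≡ fromM d (mat₂ 0 n u)
mat±1≡fromM d n (zero , l) = trans (cong (coef l •M_) (Aₜ-fromℤ d (+ 1))) (•M-fromM d (coef l) _)
mat±1≡fromM d n (suc zero , l) = trans (cong (coef l •M_) (Aₜ-fromℤ d (- + 1))) (•M-fromM d (coef l) _)

Aut-mat±1≃G₂-over-ℤ : ∀ d n → AutGroup (Fin 2 × Coef n) (ZAdj (mat±1 d n)) ≃ᴳ G₂ 0 n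
Aut-mat±1≃G₂-over-ℤ d n =
  Aut-cong (↔-id _) λ u v → ZAdj-fromM⇔ d (mat₂ 0 n) u v ⇔-∘ ZAdj-cong (mat±1≡fromM d n) u v

G₂≃G₂-over-ℤ : ∀ d n → d ≢ 1 → d ≢ 3 → G₂ d n ≃ᴳ G₂ 0 n
G₂≃G₂-over-ℤ 0 n _ _ = Aut-mat±1≃G₂-over-ℤ 0 n
G₂≃G₂-over-ℤ 1 n d≢1 _ = ⊥-elim (d≢1 refl)
G₂≃G₂-over-ℤ 2 n _ _ = Aut-mat±1≃G₂-over-ℤ 2 n
G₂≃G₂-over-ℤ 3 n _ d≢3 = ⊥-elim (d≢3 refl)
G₂≃G₂-over-ℤ (suc (suc (suc (suc k)))) n _ _ = Aut-mat±1≃G₂-over-ℤ _ n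

-- Identifying Γ₁ and Γ₂ with the model graphs

Coef↔Fin : ∀ n → Coef n ↔ Fin (2 * n)
Coef↔Fin n = ↔-sym (Fin.*↔× {2} {n}) ↔-∘ (sign↔ ×-↔ ↔-id (Fin n))
  where
  sign↔ : Sign ↔ Fin 2
  sign↔ = mk↔ₛ′ (λ { Sign.- → zero ; Sign.+ → suc zero }) (λ { zero → Sign.- ; (suc zero) → Sign.+ })
                (λ { zero → refl ; (suc zero) → refl }) (λ { Sign.- → refl ; Sign.+ → refl })

Bool×↔⊎ : {A : Set} → (Bool × A) ↔ (A ⊎ A)
Bool×↔⊎ = mk↔ₛ′ (λ { (false , x) → inj₁ x ; (true , x) → inj₂ x })
                (λ { (inj₁ x) → false , x ; (inj₂ x) → true , x })
                (λ { (inj₁ x) → refl ; (inj₂ x) → refl }) (λ { (false , x) → refl ; (true , x) → refl })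

Fin-nontrivial : ∀ {m} → 2 ≤ m → Nontrivial (Fin m)
Fin-nontrivial (s≤s (s≤s _)) zero = suc zero , λ ()
Fin-nontrivial (s≤s (s≤s _)) (suc i) = zero , λ ()

Fin-point : ∀ {k m} → suc k ≤ m → Fin m
Fin-point (s≤s _) = zero

coef-nonZero : ∀ {n} (l : Coef n) → ℤ.NonZero (coef l)
coef-nonZero (Sign.- , _) = _
coef-nonZero (Sign.+ , _) = _

E₁₁ E₂₂ : M₂ 0
E₁₁ = Aₜ (+ 0)
E₂₂ = mat (+ 0) (+ 0) (+ 0) (+ 1)

diagonal : Bool → M₂ 0
diagonal false = E₁₁
diagonal true = E₂₂

Γ₁⇔BlockGraph : ∀ n u v → ZAdj (mat₁ 0 n) u v ⇔ BlockGraph inRight (ZeroDivisorTable diagonal) u v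
Γ₁⇔BlockGraph n = ZAdj-multiples⇔BlockGraph diagonal inRight coefficient (mat₁ 0 n) nonZero mat₁≡multiple
  where
  coefficient : V₁ n → ℤ
  coefficient (inj₁ l) = coef l
  coefficient (inj₂ l) = coef l
  nonZero : ∀ u → ℤ.NonZero (coefficient u)
  nonZero (inj₁ l) = coef-nonZero l
  nonZero (inj₂ l) = coef-nonZero l
  mat₁≡multiple : ∀ u → mat₁ 0 n u ≡ coefficient u •M diagonal (inRight u)
  mat₁≡multiple (inj₁ l) = refl
  mat₁≡multiple (inj₂ l) = mat-cong 0≡ 0≡ 0≡ (sym (ℤ.*-identityʳ (coef l)))
    where 0≡ = sym (ℤ.*-zeroʳ (coef l))

unitMatrices : (d : ℕ) → Fin (length (U d)) → M₂ d
unitMatrices d j = Aₜ (lookup (U d) j)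

Γ₂⇔BlockGraph : ∀ d n u v → ZAdj (mat₂ d n) u v ⇔ BlockGraph proj₁ (ZeroDivisorTable (unitMatrices d)) u v
Γ₂⇔BlockGraph d n =
  ZAdj-multiples⇔BlockGraph (unitMatrices d) proj₁ (coef ∘ proj₂) (mat₂ d n) (coef-nonZero ∘ proj₂) (λ _ → refl)

Fin2×↔⊎ : {A : Set} → (Fin 2 × A) ↔ (A ⊎ A)
Fin2×↔⊎ = Bool×↔⊎ ↔-∘ (Fin.2↔Bool ×-↔ ↔-id _)

splitHalves : ∀ n → (Fin 2 × Coef n) ↔ (Fin (2 * n) ⊎ Fin (2 * n))
splitHalves n = (Coef↔Fin n ⊎-↔ Coef↔Fin n) ↔-∘ Fin2×↔⊎

inRight-splitHalves : ∀ n j l → inRight (Inverse.to (splitHalves n) (j , l)) ≡ Inverse.to Fin.2↔Bool j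
inRight-splitHalves n zero l = refl
inRight-splitHalves n (suc zero) l = refl

module _ (n : ℕ) (1≤n : 1 ≤ n) where

  private
    m = 2 * n
    2≤m : 2 ≤ m
    2≤m = ℕ.*-monoʳ-≤ 2 1≤n

  partA : ∀ d → G₁ d n ≃ᴳ SemidirectProduct (Sym m ×ᴳ Sym m) C₂ (swapAction (Sym m))
  partA d = ≃ᴳ-trans (G₁≃G₁-over-ℤ d n) (≃ᴳ-trans
    (Aut-cong relabel λ u v →
      BlockGraph-relabel {blk = inRight} {blk' = proj₁} {t = ZeroDivisorTable diagonal} {t' = _xor_} relabel (λ b → b) side-relabel table u v
      ⇔-∘ Γ₁⇔BlockGraph n u v)
    (Aut-CompleteBipartite≃ (Fin-point 2≤m)))
    where
    relabel : V₁ n ↔ (Bool × Fin m)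
    relabel = (↔-id Bool ×-↔ Coef↔Fin n) ↔-∘ ↔-sym Bool×↔⊎
    side-relabel : ∀ u → proj₁ (Inverse.to relabel u) ≡ inRight u
    side-relabel (inj₁ _) = refl
    side-relabel (inj₂ _) = refl
    table : ∀ i j → i xor j ≡ ZeroDivisorTable diagonal i j
    table false false = refl
    table false true = refl
    table true false = refl
    table true true = refl

  partB-over-ℤ : G₂ 0 n ≃ᴳ (Sym m ×ᴳ Sym m)
  partB-over-ℤ = ≃ᴳ-trans
    (Aut-cong (splitHalves n) λ u v →
      BlockGraph-relabel {blk = proj₁} {blk' = inRight} {t = ZeroDivisorTable (unitMatrices 0)} {t' = _∨_} (splitHalves n) sign
        (λ (j , l) → inRight-splitHalves n j l) table u v
      ⇔-∘ Γ₂⇔BlockGraph 0 n u v)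
    (Aut-IndependentJoinClique≃ (Fin-nontrivial 2≤m))
    where
    sign : Fin 2 → Bool
    sign = Inverse.to Fin.2↔Bool
    table : ∀ i j → sign i ∨ sign j ≡ ZeroDivisorTable (unitMatrices 0) i j
    table = from-yes (tablesAgree? (λ i j → sign i ∨ sign j) (ZeroDivisorTable (unitMatrices 0)))

  partC : G₂ 1 n ≃ᴳ (Sym m ×ᴳ (Sym m ×ᴳ Sym (4 * n)))
  partC = ≃ᴳ-trans
    (Aut-cong relabel λ u v →
      BlockGraph-relabel {blk = proj₁} {blk' = threeBlocks} {t = ZeroDivisorTable (unitMatrices 1)}
        {t' = independentJoinCliquePlusIndependentTable}
        relabel block block-relabel table u v
      ⇔-∘ Γ₂⇔BlockGraph 1 n u v)
    (Aut-IndependentJoinCliquePlusIndependent≃ (Fin-point 2≤m) (Fin-point 2≤m) (Fin-nontrivial 2≤m)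
      (Fin-point (ℕ.*-monoʳ-≤ 4 1≤n)))
    where
    pairs↔Fin : (Fin 2 × Coef n) ↔ Fin (4 * n)
    pairs↔Fin = subst (λ k → Fin (2 * m) ↔ Fin k) (sym (ℕ.*-assoc 2 2 n)) (↔-id _)
             ↔-∘ (↔-sym (Fin.*↔× {2} {m}) ↔-∘ (↔-id (Fin 2) ×-↔ Coef↔Fin n))
    relabel : (Fin 4 × Coef n) ↔ (Fin m ⊎ (Fin m ⊎ Fin (4 * n)))
    relabel = ⊎-assoc 0ℓ _ _ _
          ↔-∘ ((splitHalves n ⊎-↔ pairs↔Fin)
          ↔-∘ (×-distribʳ-⊎ 0ℓ (Coef n) (Fin 2) (Fin 2)
          ↔-∘ (Fin.+↔⊎ {2} {2} ×-↔ ↔-id (Coef n))))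
    -- U 1 lists 1, -1, i, -i; the vertices for ±i form one block.
    block : Fin 4 → Fin 3
    block zero = zero
    block (suc zero) = suc zero
    block (suc (suc _)) = suc (suc zero)
    block-relabel : ∀ u → threeBlocks (Inverse.to relabel u) ≡ block (proj₁ u)
    block-relabel (zero , l) = refl
    block-relabel (suc zero , l) = refl
    block-relabel (suc (suc zero) , l) = refl
    block-relabel (suc (suc (suc zero)) , l) = refl
    table : ∀ i j → independentJoinCliquePlusIndependentTable (block i) (block j) ≡ ZeroDivisorTable (unitMatrices 1) i j
    table = from-yes (tablesAgree? (λ i j → independentJoinCliquePlusIndependentTable (block i) (block j))
                                   (ZeroDivisorTable (unitMatrices 1)))

  partD : G₂ 3 n ≃ᴳ Wreath 3 (Sym m ×ᴳ Sym m)
  partD = ≃ᴳ-trans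
    (Aut-cong relabel λ u v →
      ⇔-sym (Copies⇔BlockGraph inRight _∨_ _ _)
      ⇔-∘ (BlockGraph-relabel {blk = proj₁} {blk' = onCopies inRight} {t = ZeroDivisorTable (unitMatrices 3)}
           {t' = copiesTable _∨_} relabel block block-relabel table u v
      ⇔-∘ Γ₂⇔BlockGraph 3 n u v))
    (≃ᴳ-trans
      (Aut-Copies≃Wreath (inj₁ (Fin-point 2≤m)) (IndependentJoinClique-diameter≤2 (Fin-point 2≤m) (Fin-point 2≤m)))
      (wreath-cong 3 (Aut-IndependentJoinClique≃ (Fin-nontrivial 2≤m))))
    where
    relabel : (Fin 6 × Coef n) ↔ (Fin 3 × (Fin m ⊎ Fin m))
    relabel = (↔-id (Fin 3) ×-↔ splitHalves n)
          ↔-∘ (×-assoc 0ℓ (Fin 3) (Fin 2) (Coef n)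
          ↔-∘ (Fin.*↔× {3} {2} ×-↔ ↔-id (Coef n)))
    -- U 3 lists ±1, ±ω, ±ω² in consecutive pairs, so index 2ℓ + s lies in copy ℓ.
    block : Fin 6 → Fin 3 × Bool
    block j = proj₁ (Fin.remQuot {3} 2 j) , Inverse.to Fin.2↔Bool (proj₂ (Fin.remQuot {3} 2 j))
    block-relabel : ∀ u → onCopies inRight (Inverse.to relabel u) ≡ block (proj₁ u)
    block-relabel (j , l) =
      cong (proj₁ (Fin.remQuot {3} 2 j) ,_) (inRight-splitHalves n (proj₂ (Fin.remQuot {3} 2 j)) l)
    table : ∀ i j → copiesTable _∨_ (block i) (block j) ≡ ZeroDivisorTable (unitMatrices 3) i j
    table = from-yes (tablesAgree? (λ i j → copiesTable _∨_ (block i) (block j)) (ZeroDivisorTable (unitMatrices 3)))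

theorem4p5 : (d : ℕ) → Admissible d → (n : ℕ) → 1 ≤ n →
    (G₁ d n ≅ᴳ SemidirectProduct (Sym (2 * n) ×ᴳ Sym (2 * n)) C₂ (swapAction (Sym (2 * n))))
  × (d ≢ 1 → d ≢ 3 → G₂ d n ≅ᴳ (Sym (2 * n) ×ᴳ Sym (2 * n)))
  × (d ≡ 1 → G₂ d n ≅ᴳ (Sym (2 * n) ×ᴳ (Sym (2 * n) ×ᴳ Sym (4 * n))))
  × (d ≡ 3 → G₂ d n ≅ᴳ SemidirectProduct (PowerGroup 3 (Sym (2 * n) ×ᴳ Sym (2 * n))) (Sym 3)
                           (permuteAction 3 (Sym (2 * n) ×ᴳ Sym (2 * n))))
-- Square-freeness of d is what makes R the ring of integers in the paper; the argument never uses it.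
theorem4p5 d _ n 1≤n =
    ≃ᴳ⇒≅ᴳ (partA n 1≤n d)
  , (λ d≢1 d≢3 → ≃ᴳ⇒≅ᴳ (≃ᴳ-trans (G₂≃G₂-over-ℤ d n d≢1 d≢3) (partB-over-ℤ n 1≤n)))
  , (λ { refl → ≃ᴳ⇒≅ᴳ (partC n 1≤n) })
  , (λ { refl → ≃ᴳ⇒≅ᴳ (partD n 1≤n) })
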